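{- Let $f$ be a symmetric function (over $\mathbb{Q}$). Then for every $n \geq 1$, $f(\xi_1,\ldots,\xi_n)$ belongs to $\mathcal{A}_n$. Moreover, for every $n \geq 1$, $\pi_n\big(f(\xi_1,\ldots,\xi_{n+1})\big) = f(\xi_1,\ldots,\xi_n)$, so that the sequence $\big(f(\xi_1,\ldots,\xi_n)\big)_{n\geq 1}$ defines an element $f(\Xi)$ of the projective limit $\mathcal{A}_\infty$.
   Context: A partial permutation is a pair $(\sigma,d)$ where $d$ is a finite set of positive integers and $\sigma$ is a permutation of $d$. The product is $(\sigma,d)\cdot(\sigma',d') = (\tilde\sigma\circ\tilde\sigma', d\cup d')$, where $\tilde\sigma$ (resp. $\tilde\sigma'$) is the permutation of $d \cup d'$ acting as $\sigma$ on $d$ (resp. $\sigma'$ on $d'$) and fixing the other points. $\mathcal{B}_n$ is the $\mathbb{Q}$-algebra with basis the partial permutations $(\sigma,d)$ with $d \subseteq \{1,\ldots,n\}$ and this product. The group $S_n$ acts on $\mathcal{B}_n$ by $\tau\cdot(\sigma,d) = (\tau\sigma\tau^{ -1},\tau(d))$, and $\mathcal{A}_n$ is the subalgebra of elements fixed by all $\tau \in S_n$. The map $\pi_n:\mathcal{B}_{n+1}\to\mathcal{B}_n$ is the algebra morphism sending $(\sigma,d)$ to itself if $d\subseteq\{1,\ldots,n\}$ and to $0$ otherwise; it maps $\mathcal{A}_{n+1}$ to $\mathcal{A}_n$, and $\mathcal{A}_\infty$ is the projective limit of the $\mathcal{A}_n$ along these maps (sequences $(a_n)$ with $a_n\in\mathcal{A}_n$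 and $\pi_n(a_{n+1})=a_n$). The partial Jucys–Murphy elements are $\xi_i = \sum_{j<i} \big((j\ i),\{j,i\}\big)$; they pairwise commute, so $f(\xi_1,\ldots,\xi_n)$ is well defined. -}

module Defs where

open import Data.Bool using (Bool; true; false; if_then_else_; _∧_)
open import Data.Nat as ℕ using (ℕ; zero; suc; _≥_)
open import Data.Fin as Fin using (Fin; toℕ; fromℕ)
open import Data.Fin.Subset using (Subset; ⁅_⁆; _∪_; _∉_) renaming (⊥ to ∅)
open import Data.Fin.Permutation
  using (Permutation′; _⟨$⟩ʳ_; _⟨$⟩ˡ_; id; flip; _∘ₚ_; transpose; remove)
open import Data.Vec as Vec using (Vec; tabulate; last; init; lookup)
import Data.Vec.Properties as VecP
open import Data.List as List
  using (List; []; _∷_; _++_; map; concatMap; filterᵇ; allFin; foldr; upTo; applyUpTo)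
open import Data.Bool.ListAction using (and)
open import Data.Nat.ListAction using (sum)
open import Data.List.Relation.Unary.All using (All)
open import Data.List.Relation.Unary.Linked using (Linked)
open import Data.Product using (_×_; _,_; proj₁; proj₂)
open import Data.Rational as ℚ using (ℚ; 0ℚ; 1ℚ)
open import Relation.Nullary using (does)
open import Relation.Binary.PropositionalEquality using (_≡_)
import Data.Bool.Properties as BoolP

-- Partial permutations of [n] = {1,…,n}; Fin n index i stands for i+1.
-- A raw pair (σ , d): σ a permutation of the whole of [n], d ⊆ [n].
-- It is a partial permutation (the permutation σ|d of d, extended by the
-- identity) exactly when σ fixes every point outside d (Valid).

PP : ℕ → Set
PP n = Permutation′ n × Subset n

Valid : ∀ {n} → PP n → Set
Valid {n} (σ , d) = ∀ (i : Fin n) → i ∉ d → σ ⟨$⟩ʳ i ≡ i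

eqPP : ∀ {n} → PP n → PP n → Bool
eqPP {n} (σ , d) (τ , e) =
  and (map (λ i → does (σ ⟨$⟩ʳ i Fin.≟ τ ⟨$⟩ʳ i)) (allFin n))
  ∧ does (VecP.≡-dec BoolP._≟_ d e)

-- product of partial permutations: (σ,d)(σ',d') = (σ ∘ σ', d ∪ d')
-- (σ' applied first; _∘ₚ_ is diagrammatic composition)
mulPP : ∀ {n} → PP n → PP n → PP n
mulPP (σ , d) (σ′ , d′) = (σ′ ∘ₚ σ , d ∪ d′)

-- action τ·(σ,d) = (τ σ τ⁻¹ , τ(d))
actPP : ∀ {n} → Permutation′ n → PP n → PP n
actPP τ (σ , d) = (flip τ ∘ₚ σ ∘ₚ τ , tabulate (λ i → lookup d (τ ⟨$⟩ˡ i)))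

-- The algebra B_n: formal ℚ-linear combinations of partial permutations

B : ℕ → Set
B n = List (ℚ × PP n)

coeff : ∀ {n} → B n → PP n → ℚ
coeff a x = foldr (λ cy r → if eqPP (proj₂ cy) x then proj₁ cy ℚ.+ r else r) 0ℚ a

_≈_ : ∀ {n} → B n → B n → Set
a ≈ b = ∀ x → coeff a x ≡ coeff b x

InB : ∀ {n} → B n → Set
InB a = All (λ cx → Valid (proj₂ cx)) a

0B : ∀ {n} → B n
0B = []

1B : ∀ {n} → B n
1B = (1ℚ , (id , ∅)) ∷ []

_+B_ : ∀ {n} → B n → B n → B n
_+B_ = _++_

_·B_ : ∀ {n} → ℚ → B n → B n
c ·B a = map (λ dx → (c ℚ.* proj₁ dx , proj₂ dx)) a

_*B_ : ∀ {n} → B n → B n → B n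
a *B b = concatMap (λ cx → map (λ dy → (proj₁ cx ℚ.* proj₁ dy , mulPP (proj₂ cx) (proj₂ dy))) b) a

_^B_ : ∀ {n} → B n → ℕ → B n
a ^B zero = 1B
a ^B suc k = a *B (a ^B k)

act : ∀ {n} → Permutation′ n → B n → B n
act τ a = map (λ cx → (proj₁ cx , actPP τ (proj₂ cx))) a

InA : ∀ {n} → B n → Set
InA {n} a = InB a × (∀ (τ : Permutation′ n) → act τ a ≈ a)

-- π_n : B_{n+1} → B_n ; (σ,d) ↦ (σ,d) if n+1 ∉ d, else 0.
-- When n+1 ∉ d, σ fixes n+1 and  remove (fromℕ n) σ  is σ restricted to [n].
πPP : ∀ {n} → ℚ × PP (suc n) → B n
πPP {n} (c , (σ , d)) = if last d then [] else ((c , (remove (fromℕ n) σ , init d)) ∷ [])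

π : ∀ {n} → B (suc n) → B n
π a = concatMap πPP a

ξ : ∀ {n} → Fin n → B n
ξ {n} i = map (λ j → (1ℚ , (transpose j i , ⁅ j ⁆ ∪ ⁅ i ⁆)))
              (filterᵇ (λ j → toℕ j ℕ.<ᵇ toℕ i) (allFin n))

-- Symmetric functions over ℚ, in the monomial basis:
-- a symmetric function is a finite ℚ-linear combination Σ c_λ m_λ
-- of monomial symmetric functions indexed by partitions λ.

record Partition : Set where
  constructor mkPartition
  field
    parts      : List ℕ
    decreasing : Linked _≥_ parts
    positive   : All (λ k → k ≥ 1) parts
open Partition public

SymFun : Set
SymFun = List (ℚ × Partition)

vecsUpTo : ℕ → (n : ℕ) → List (Vec ℕ n)
vecsUpTo N zero = Vec.[] ∷ []
vecsUpTo N (suc n) = concatMap (λ k → map (k Vec.∷_) (vecsUpTo N n)) (upTo (suc N))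

occ : ℕ → List ℕ → ℕ
occ k xs = List.length (filterᵇ (λ x → x ℕ.≡ᵇ k) xs)

-- α ∈ ℕ^n is a rearrangement of λ (padded with zeros): the multiset of
-- nonzero entries of α equals the multiset of parts of λ.
-- (All entries of such α are ≤ |λ| = sum of parts.)
isRearr : ∀ {n} → List ℕ → Vec ℕ n → Bool
isRearr λs α = and (map (λ k → occ k (Vec.toList α) ℕ.≡ᵇ occ k λs)
                        (applyUpTo suc (sum λs)))

exponents : (n : ℕ) → Partition → List (Vec ℕ n)
exponents n λp = filterᵇ (isRearr (parts λp)) (vecsUpTo (sum (parts λp)) n)

monomialAt : ∀ {n} → (Fin n → B n) → Vec ℕ n → B n
monomialAt {n} x α = foldr (λ i r → (x i ^B lookup α i) *B r) 1B (allFin n)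

evalMono : ∀ {n} → (Fin n → B n) → Partition → B n
evalMono {n} x λp = foldr (λ α r → monomialAt x α +B r) 0B (exponents n λp)

evalSym : ∀ {n} → SymFun → (Fin n → B n) → B n
evalSym f x = foldr (λ cλ r → (proj₁ cλ ·B evalMono x (proj₂ cλ)) +B r) 0B f

fξ : SymFun → (n : ℕ) → B n
fξ f n = evalSym f (ξ {n})

module Submission where

-- Rather than normalising lists we compare
-- elements through linear functionals: a ≃ b when every functional on basis
-- elements that respects the data of partial permutations takes the same
-- value on a and b.  Coordinate functionals give a ≃ b ⇒ a ≈ b, and ≃ is
-- easily shown to be a congruence making B_n a ℚ-algebra.
--
-- (1) The action of τ ∈ S_n and the projection π_n (on valid elements) are
-- algebra maps, hence commute with evaluating f.  S_n is generated by the
-- adjacent transpositions s = (I I+1); s fixes ξ_k for k ∉ {I, I+1} and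
-- preserves ξ_I + ξ_{I+1} and ξ_I ξ_{I+1}.  As the ξ's commute, Newton's
-- identities show that a symmetric expression in a commuting pair only
-- depends on its sum and product, so f(s·ξ) = f(ξ).
-- (2) π_n ξ_k = ξ_k for k ≤ n and π_n ξ_{n+1} = 0, and
-- m_λ(x_1,…,x_n,0) = m_λ(x_1,…,x_n) for every monomial symmetric function.

open import Defs
open import Data.Nat as ℕ using (ℕ; zero; suc; _≥_)
import Data.Nat.Properties as NP
open import Data.Nat.ListAction using () renaming (sum to sumℕ)
open import Data.Product using (_×_; _,_; proj₁; proj₂; Σ)
open import Data.Sum using (_⊎_; inj₁; inj₂)
open import Data.Unit using (⊤; tt)
open import Data.Empty using (⊥-elim)
open import Data.Bool using (Bool; true; false; _∧_; _∨_; if_then_else_; T)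
import Data.Bool.Properties as BoolP
open import Data.Bool.ListAction using (and)
open import Data.Fin as Fin using (Fin; toℕ; fromℕ; inject₁; punchIn)
import Data.Fin.Properties as FinP
open import Data.Fin.Subset using (Subset; ⁅_⁆; _∪_; _∉_) renaming (⊥ to ∅)
open import Data.Fin.Permutation
  using (Permutation′; _⟨$⟩ʳ_; _⟨$⟩ˡ_; id; _∘ₚ_; transpose; remove; inverseˡ; inverseʳ; punchIn-permute)
  renaming (_≈_ to _≈ₚ_)
open import Data.Fin.Permutation.Transposition.List using (TranspositionList; eval; decompose; eval-decompose)
open import Data.Vec as Vec using (Vec; lookup; tabulate; _∷ʳ_)
import Data.Vec.Properties as VecP
open import Data.List as List
  using (List; []; _∷_; _++_; map; concatMap; filterᵇ; allFin; foldr; upTo; applyUpTo)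
import Data.List.Properties as ListP
open import Data.List.Relation.Unary.All as All using (All; []; _∷_)
import Data.List.Relation.Unary.All.Properties as AllP
open import Data.Rational as Q using (ℚ; 0ℚ; 1ℚ)
import Data.Rational.Properties as QP
open import Data.Rational.Solver using (module +-*-Solver)
open import Algebra.Bundles using (CommutativeMonoid; CommutativeRing)
open import Algebra.Properties.CommutativeSemigroup
  (CommutativeMonoid.commutativeSemigroup QP.+-0-commutativeMonoid)
  using () renaming (interchange to +-interchange; x∙yz≈y∙xz to +-leftSwap; xy∙z≈xz∙y to +-rightSwap)
open import Algebra.Properties.CommutativeSemigroup
  (CommutativeMonoid.commutativeSemigroup QP.*-1-commutativeMonoid)
  using () renaming (x∙yz≈y∙xz to *-leftSwap)
open import Algebra.Properties.Group QP.+-0-group using (∙-cancelʳ)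
open import Algebra.Properties.Semiring.Sum (CommutativeRing.semiring QP.+-*-commutativeRing)
  using (sum; sum-cong-≗; sum-permute; sum-init-last; sum-replicate-zero; ∑-distrib-+; ∑-comm; *-distribˡ-sum)
import Algebra.Solver.IdempotentCommutativeMonoid BoolP.∨-idempotentCommutativeMonoid as ∨-Solver
open import Relation.Nullary using (Dec; yes; no; does; ¬_)
open import Relation.Nullary.Decidable using (dec-true; dec-false)
open import Relation.Binary.Definitions using (tri<; tri≈; tri>)
open import Relation.Binary.PropositionalEquality
open import Relation.Binary.Bundles using (Setoid)
open import Level using (0ℓ)
import Relation.Binary.Reasoning.Setoid as SetoidReasoning

record _≐_ {n} (x y : PP n) : Set where
  constructor _,_
  field
    perm : ∀ i → proj₁ x ⟨$⟩ʳ i ≡ proj₁ y ⟨$⟩ʳ i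
    sub  : ∀ i → lookup (proj₂ x) i ≡ lookup (proj₂ y) i
open _≐_ public

≐-refl : ∀ {n} (x : PP n) → x ≐ x
≐-refl x = (λ i → refl) , (λ i → refl)

≐-reflexive : ∀ {n} {x y : PP n} → x ≡ y → x ≐ y
≐-reflexive refl = ≐-refl _

≐-sym : ∀ {n} {x y : PP n} → x ≐ y → y ≐ x
≐-sym (p , q) = (λ i → sym (p i)) , (λ i → sym (q i))

≐-trans : ∀ {n} {x y z : PP n} → x ≐ y → y ≐ z → x ≐ z
≐-trans (p , q) (p' , q') = (λ i → trans (p i) (p' i)) , (λ i → trans (q i) (q' i))

and-tabulate⁺ : ∀ {m k} (f : Fin k → Bool) (h : Fin m → Fin k) →
  (∀ j → f (h j) ≡ true) → and (map f (List.tabulate h)) ≡ true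
and-tabulate⁺ {zero}  f h p = refl
and-tabulate⁺ {suc m} f h p rewrite p Fin.zero =
  and-tabulate⁺ f (λ j → h (Fin.suc j)) (λ j → p (Fin.suc j))

and-tabulate⁻ : ∀ {m k} (f : Fin k → Bool) (h : Fin m → Fin k) →
  and (map f (List.tabulate h)) ≡ true → ∀ j → f (h j) ≡ true
and-tabulate⁻ {suc m} f h e j with f (h Fin.zero) in eq
and-tabulate⁻ {suc m} f h e Fin.zero    | true = eq
and-tabulate⁻ {suc m} f h e (Fin.suc j) | true = and-tabulate⁻ f (λ j → h (Fin.suc j)) e j

vec-ext : ∀ {n} {A : Set} (d e : Vec A n) → (∀ i → lookup d i ≡ lookup e i) → d ≡ e
vec-ext d e p =
  trans (sym (VecP.tabulate∘lookup d)) (trans (VecP.tabulate-cong p) (VecP.tabulate∘lookup e))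

does-true : ∀ {A : Set} (d : Dec A) → does d ≡ true → A
does-true (yes p) _ = p

∧-true : ∀ {a b : Bool} → (a ∧ b) ≡ true → (a ≡ true) × (b ≡ true)
∧-true {true} {true} _ = refl , refl

eqPP-complete : ∀ {n} (x y : PP n) → x ≐ y → eqPP x y ≡ true
eqPP-complete {n} (σ , d) (τ , e) (p , q)
  rewrite and-tabulate⁺ (λ i → does (σ ⟨$⟩ʳ i Fin.≟ τ ⟨$⟩ʳ i)) (λ i → i)
            (λ j → dec-true (σ ⟨$⟩ʳ j Fin.≟ τ ⟨$⟩ʳ j) (p j))
  = dec-true (VecP.≡-dec BoolP._≟_ d e) (vec-ext d e q)

eqPP-sound : ∀ {n} (x y : PP n) → eqPP x y ≡ true → x ≐ y
eqPP-sound {n} (σ , d) (τ , e) t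
  with ∧-true {and (map (λ i → does (σ ⟨$⟩ʳ i Fin.≟ τ ⟨$⟩ʳ i)) (allFin n))} t
... | t₁ , t₂ =
  (λ i → does-true (σ ⟨$⟩ʳ i Fin.≟ τ ⟨$⟩ʳ i) (and-tabulate⁻ _ (λ i → i) t₁ i)) ,
  (λ i → cong (λ v → lookup v i) (does-true (VecP.≡-dec BoolP._≟_ d e) t₂))

eqPP-respˡ : ∀ {n} {y y' : PP n} (x : PP n) → y ≐ y' → eqPP y x ≡ eqPP y' x
eqPP-respˡ {y = y} {y'} x r with eqPP y x in e₁ | eqPP y' x in e₂
... | true  | true  = refl
... | false | false = refl
... | true  | false = sym (trans (sym e₂) (eqPP-complete y' x (≐-trans (≐-sym r) (eqPP-sound y x e₁))))
... | false | true  = trans (sym e₁) (eqPP-complete y x (≐-trans r (eqPP-sound y' x e₂)))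

ind : Bool → ℚ
ind true  = 1ℚ
ind false = 0ℚ

Lin : ∀ {n} → (PP n → ℚ) → B n → ℚ
Lin g []             = 0ℚ
Lin g ((c , y) ∷ a) = c Q.* g y Q.+ Lin g a

Respectful : ∀ {n} → (PP n → ℚ) → Set
Respectful {n} g = ∀ {y y' : PP n} → y ≐ y' → g y ≡ g y'

δ : ∀ {n} → PP n → PP n → ℚ
δ x y = ind (eqPP y x)

δ-respectful : ∀ {n} (x : PP n) → Respectful (δ x)
δ-respectful x r = cong ind (eqPP-respˡ x r)

coeff≡Lin-δ : ∀ {n} (a : B n) (x : PP n) → coeff a x ≡ Lin (δ x) a
coeff≡Lin-δ []            x = refl
coeff≡Lin-δ ((c , y) ∷ a) x with eqPP y x
... | true  = cong₂ Q._+_ (sym (QP.*-identityʳ c)) (coeff≡Lin-δ a x)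
... | false = trans (coeff≡Lin-δ a x)
                (sym (trans (cong (Q._+ Lin (δ x) a) (QP.*-zeroʳ c)) (QP.+-identityˡ _)))

Lin-++ : ∀ {n} (g : PP n → ℚ) (a b : B n) → Lin g (a ++ b) ≡ Lin g a Q.+ Lin g b
Lin-++ g []            b = sym (QP.+-identityˡ _)
Lin-++ g ((c , y) ∷ a) b =
  trans (cong (c Q.* g y Q.+_) (Lin-++ g a b)) (sym (QP.+-assoc (c Q.* g y) (Lin g a) (Lin g b)))

Lin-· : ∀ {n} (g : PP n → ℚ) (c : ℚ) (a : B n) → Lin g (c ·B a) ≡ c Q.* Lin g a
Lin-· g c []            = sym (QP.*-zeroʳ c)
Lin-· g c ((d , y) ∷ a) =
  trans (cong₂ Q._+_ (QP.*-assoc c d (g y)) (Lin-· g c a)) (sym (QP.*-distribˡ-+ c (d Q.* g y) (Lin g a)))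

Lin-cong : ∀ {n} {g h : PP n → ℚ} (a : B n) → (∀ y → g y ≡ h y) → Lin g a ≡ Lin h a
Lin-cong []            p = refl
Lin-cong ((c , y) ∷ a) p = cong₂ Q._+_ (cong (c Q.*_) (p y)) (Lin-cong a p)

Lin-0 : ∀ {n} (a : B n) → Lin (λ _ → 0ℚ) a ≡ 0ℚ
Lin-0 []            = refl
Lin-0 ((c , y) ∷ a) = trans (cong₂ Q._+_ (QP.*-zeroʳ c) (Lin-0 a)) (QP.+-identityˡ 0ℚ)

Lin-+ : ∀ {n} (g h : PP n → ℚ) (a : B n) → Lin (λ y → g y Q.+ h y) a ≡ Lin g a Q.+ Lin h a
Lin-+ g h []            = sym (QP.+-identityˡ 0ℚ)
Lin-+ g h ((c , y) ∷ a) =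
  trans (cong₂ Q._+_ (QP.*-distribˡ-+ c (g y) (h y)) (Lin-+ g h a))
        (+-interchange (c Q.* g y) (c Q.* h y) (Lin g a) (Lin h a))

Lin-scale : ∀ {n} (c : ℚ) (h : PP n → ℚ) (a : B n) → Lin (λ y → c Q.* h y) a ≡ c Q.* Lin h a
Lin-scale c h []            = sym (QP.*-zeroʳ c)
Lin-scale c h ((d , y) ∷ a) =
  trans (cong₂ Q._+_ (*-leftSwap d c (h y)) (Lin-scale c h a))
        (sym (QP.*-distribˡ-+ c (d Q.* h y) (Lin h a)))

Lin-Fubini : ∀ {n} (h : PP n → PP n → ℚ) (a b : B n) →
  Lin (λ y → Lin (h y) b) a ≡ Lin (λ z → Lin (λ y → h y z) a) b
Lin-Fubini h []            b = sym (Lin-0 b)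
Lin-Fubini h ((c , y) ∷ a) b = begin
  c Q.* Lin (h y) b Q.+ Lin (λ y → Lin (h y) b) a
    ≡⟨ cong₂ Q._+_ (sym (Lin-scale c (h y) b)) (Lin-Fubini h a b) ⟩
  Lin (λ z → c Q.* h y z) b Q.+ Lin (λ z → Lin (λ y → h y z) a) b
    ≡⟨ sym (Lin-+ _ _ b) ⟩
  Lin (λ z → c Q.* h y z Q.+ Lin (λ y → h y z) a) b ∎
  where open ≡-Reasoning

-- Weak equality: every respectful functional takes the same value.
-- It implies equality of all coefficients (≃⇒≈), and unlike _≈_ it is
-- easily seen to be a congruence for all operations on B_n.
record _≃_ {n} (a b : B n) : Set where
  constructor functionally
  field agree : ∀ (g : PP n → ℚ) → Respectful g → Lin g a ≡ Lin g b
open _≃_ public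

infix 4 _≃_

≃⇒≈ : ∀ {n} {a b : B n} → a ≃ b → a ≈ b
≃⇒≈ {a = a} {b} e x =
  trans (coeff≡Lin-δ a x) (trans (agree e (δ x) (δ-respectful x)) (sym (coeff≡Lin-δ b x)))

≃-refl : ∀ {n} {a : B n} → a ≃ a
≃-refl = functionally λ g rg → refl

≃-reflexive : ∀ {n} {a b : B n} → a ≡ b → a ≃ b
≃-reflexive refl = ≃-refl

≃-sym : ∀ {n} {a b : B n} → a ≃ b → b ≃ a
≃-sym e = functionally λ g rg → sym (agree e g rg)

≃-trans : ∀ {n} {a b c : B n} → a ≃ b → b ≃ c → a ≃ c
≃-trans e f = functionally λ g rg → trans (agree e g rg) (agree f g rg)

≃-setoid : ℕ → Setoid 0ℓ 0ℓ
≃-setoid n = record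
  { Carrier = B n ; _≈_ = _≃_
  ; isEquivalence = record { refl = ≃-refl ; sym = ≃-sym ; trans = ≃-trans } }

module ≃-Reasoning {n : ℕ} = SetoidReasoning (≃-setoid n)

lookup-∪ : ∀ {n} (d e : Subset n) i → lookup (d ∪ e) i ≡ (lookup d i ∨ lookup e i)
lookup-∪ d e i = VecP.lookup-zipWith _∨_ i d e

lookup-∅ : ∀ {n} (i : Fin n) → lookup (∅ {n}) i ≡ false
lookup-∅ i = VecP.lookup-replicate i false

e₀ : ∀ {n} → PP n
e₀ = (id , ∅)

mulPP-resp : ∀ {n} {y y' z z' : PP n} → y ≐ y' → z ≐ z' → mulPP y z ≐ mulPP y' z'
mulPP-resp {y = σ , d} {σ' , d'} {τ , e} {τ' , e'} (p , q) (p' , q') =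
  (λ i → trans (cong (σ ⟨$⟩ʳ_) (p' i)) (p (τ' ⟨$⟩ʳ i))) ,
  (λ i → trans (lookup-∪ d e i) (trans (cong₂ _∨_ (q i) (q' i)) (sym (lookup-∪ d' e' i))))

mulPP-assoc : ∀ {n} (x y z : PP n) → mulPP (mulPP x y) z ≐ mulPP x (mulPP y z)
mulPP-assoc (σ , d) (τ , e) (ρ , f) = (λ i → refl) , λ i → begin
  lookup ((d ∪ e) ∪ f) i                 ≡⟨ lookup-∪ (d ∪ e) f i ⟩
  lookup (d ∪ e) i ∨ lookup f i          ≡⟨ cong (_∨ lookup f i) (lookup-∪ d e i) ⟩
  (lookup d i ∨ lookup e i) ∨ lookup f i ≡⟨ BoolP.∨-assoc (lookup d i) (lookup e i) (lookup f i) ⟩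
  lookup d i ∨ (lookup e i ∨ lookup f i) ≡⟨ cong (lookup d i ∨_) (lookup-∪ e f i) ⟨
  lookup d i ∨ lookup (e ∪ f) i          ≡⟨ lookup-∪ d (e ∪ f) i ⟨
  lookup (d ∪ (e ∪ f)) i                 ∎
  where open ≡-Reasoning

mulPP-identityˡ : ∀ {n} (y : PP n) → mulPP e₀ y ≐ y
mulPP-identityˡ (σ , d) =
  (λ i → refl) , (λ i → trans (lookup-∪ ∅ d i) (cong (_∨ lookup d i) (lookup-∅ i)))

mulPP-identityʳ : ∀ {n} (y : PP n) → mulPP y e₀ ≐ y
mulPP-identityʳ (σ , d) =
  (λ i → refl) ,
  (λ i → trans (lookup-∪ d ∅ i) (trans (cong (lookup d i ∨_) (lookup-∅ i)) (BoolP.∨-identityʳ _)))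

Lin-* : ∀ {n} (g : PP n → ℚ) (a b : B n) →
  Lin g (a *B b) ≡ Lin (λ y → Lin (λ z → g (mulPP y z)) b) a
Lin-* g []            b = refl
Lin-* g ((c , y) ∷ a) b =
  trans (Lin-++ g (map (λ dz → (c Q.* proj₁ dz , mulPP y (proj₂ dz))) b) (a *B b))
        (cong₂ Q._+_ (row b) (Lin-* g a b))
  where
  row : ∀ b → Lin g (map (λ dz → (c Q.* proj₁ dz , mulPP y (proj₂ dz))) b)
            ≡ c Q.* Lin (λ z → g (mulPP y z)) b
  row []            = sym (QP.*-zeroʳ c)
  row ((d , z) ∷ b) = trans (cong₂ Q._+_ (QP.*-assoc c d (g (mulPP y z))) (row b))
                            (sym (QP.*-distribˡ-+ c (d Q.* g (mulPP y z)) _))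

Lin-1B : ∀ {n} (g : PP n → ℚ) → Lin g (1B {n}) ≡ g e₀
Lin-1B g = trans (QP.+-identityʳ _) (QP.*-identityˡ _)

+-cong : ∀ {n} {a a' b b' : B n} → a ≃ a' → b ≃ b' → a +B b ≃ a' +B b'
+-cong {a = a} {a'} {b} {b'} ea eb = functionally λ g rg →
  trans (Lin-++ g a b) (trans (cong₂ Q._+_ (agree ea g rg) (agree eb g rg)) (sym (Lin-++ g a' b')))

+-comm : ∀ {n} (a b : B n) → a +B b ≃ b +B a
+-comm a b = functionally λ g rg →
  trans (Lin-++ g a b) (trans (QP.+-comm (Lin g a) (Lin g b)) (sym (Lin-++ g b a)))

+-interchangeB : ∀ {n} (a b c d : B n) → (a +B b) +B (c +B d) ≃ (a +B c) +B (b +B d)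
+-interchangeB a b c d = functionally λ g rg → begin
  Lin g ((a +B b) +B (c +B d))                    ≡⟨ Lin-++ g (a ++ b) (c ++ d) ⟩
  Lin g (a +B b) Q.+ Lin g (c +B d)               ≡⟨ cong₂ Q._+_ (Lin-++ g a b) (Lin-++ g c d) ⟩
  (Lin g a Q.+ Lin g b) Q.+ (Lin g c Q.+ Lin g d) ≡⟨ +-interchange (Lin g a) (Lin g b) (Lin g c) (Lin g d) ⟩
  (Lin g a Q.+ Lin g c) Q.+ (Lin g b Q.+ Lin g d) ≡⟨ cong₂ Q._+_ (Lin-++ g a c) (Lin-++ g b d) ⟨
  Lin g (a +B c) Q.+ Lin g (b +B d)               ≡⟨ Lin-++ g (a ++ c) (b ++ d) ⟨
  Lin g ((a +B c) +B (b +B d))                    ∎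
  where open ≡-Reasoning

+-cancelʳ : ∀ {n} {a b c c' : B n} → a +B c ≃ b +B c' → c ≃ c' → a ≃ b
+-cancelʳ {a = a} {b} {c} {c'} e ec = functionally λ g rg →
  ∙-cancelʳ (Lin g c) (Lin g a) (Lin g b)
    (trans (sym (Lin-++ g a c)) (trans (agree e g rg)
      (trans (Lin-++ g b c') (cong (Lin g b Q.+_) (sym (agree ec g rg))))))

·-cong : ∀ {n} (c : ℚ) {a a' : B n} → a ≃ a' → c ·B a ≃ c ·B a'
·-cong c {a} {a'} e = functionally λ g rg →
  trans (Lin-· g c a) (trans (cong (c Q.*_) (agree e g rg)) (sym (Lin-· g c a')))

*-cong : ∀ {n} {a a' b b' : B n} → a ≃ a' → b ≃ b' → a *B b ≃ a' *B b'
*-cong {a = a} {a'} {b} {b'} ea eb = functionally λ g rg → begin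
  Lin g (a *B b)                              ≡⟨ Lin-* g a b ⟩
  Lin (λ y → Lin (λ z → g (mulPP y z)) b) a   ≡⟨ Lin-cong a (λ y → agree eb _ (λ e → rg (mulPP-resp (≐-refl y) e))) ⟩
  Lin (λ y → Lin (λ z → g (mulPP y z)) b') a  ≡⟨ agree ea _ (λ e → Lin-cong b' (λ z → rg (mulPP-resp e (≐-refl z)))) ⟩
  Lin (λ y → Lin (λ z → g (mulPP y z)) b') a' ≡⟨ Lin-* g a' b' ⟨
  Lin g (a' *B b')                            ∎
  where open ≡-Reasoning

*-congˡ : ∀ {n} (a : B n) {b b' : B n} → b ≃ b' → a *B b ≃ a *B b'
*-congˡ a e = *-cong {a = a} {a} ≃-refl e

*-congʳ : ∀ {n} (b : B n) {a a' : B n} → a ≃ a' → a *B b ≃ a' *B b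
*-congʳ b e = *-cong {b = b} {b} e ≃-refl

*-assoc : ∀ {n} (a b c : B n) → (a *B b) *B c ≃ a *B (b *B c)
*-assoc a b c = functionally λ g rg → begin
  Lin g ((a *B b) *B c)                                                  ≡⟨ Lin-* g (a *B b) c ⟩
  Lin (λ w → Lin (λ z → g (mulPP w z)) c) (a *B b)                       ≡⟨ Lin-* _ a b ⟩
  Lin (λ x → Lin (λ y → Lin (λ z → g (mulPP (mulPP x y) z)) c) b) a
    ≡⟨ Lin-cong a (λ x → Lin-cong b (λ y → Lin-cong c (λ z → rg (mulPP-assoc x y z)))) ⟩
  Lin (λ x → Lin (λ y → Lin (λ z → g (mulPP x (mulPP y z))) c) b) a     ≡⟨ Lin-cong a (λ x → Lin-* _ b c) ⟨
  Lin (λ x → Lin (λ w → g (mulPP x w)) (b *B c)) a                       ≡⟨ Lin-* g a (b *B c) ⟨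
  Lin g (a *B (b *B c))                                                  ∎
  where open ≡-Reasoning

*-distribʳ : ∀ {n} (a b c : B n) → (a +B b) *B c ≃ (a *B c) +B (b *B c)
*-distribʳ a b c = functionally λ g rg →
  trans (Lin-* g (a ++ b) c) (trans (Lin-++ _ a b)
    (sym (trans (Lin-++ g (a *B c) (b *B c)) (cong₂ Q._+_ (Lin-* g a c) (Lin-* g b c)))))

*-distribˡ : ∀ {n} (a b c : B n) → a *B (b +B c) ≃ (a *B b) +B (a *B c)
*-distribˡ a b c = functionally λ g rg →
  trans (Lin-* g a (b ++ c)) (trans (Lin-cong a (λ y → Lin-++ _ b c))
    (trans (Lin-+ _ _ a) (sym (trans (Lin-++ g (a *B b) (a *B c)) (cong₂ Q._+_ (Lin-* g a b) (Lin-* g a c))))))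

*-identityˡ : ∀ {n} (a : B n) → 1B *B a ≃ a
*-identityˡ a = functionally λ g rg →
  trans (Lin-* g 1B a) (trans (Lin-1B (λ y → Lin (λ z → g (mulPP y z)) a)) (Lin-cong a (λ z → rg (mulPP-identityˡ z))))

*-identityʳ : ∀ {n} (a : B n) → a *B 1B ≃ a
*-identityʳ a = functionally λ g rg →
  trans (Lin-* g a 1B) (Lin-cong a (λ y → trans (Lin-1B (λ z → g (mulPP y z))) (rg (mulPP-identityʳ y))))

^-cong : ∀ {n} {a b : B n} k → a ≃ b → a ^B k ≃ b ^B k
^-cong zero    e = ≃-refl
^-cong (suc k) e = *-cong e (^-cong k e)

^-+ : ∀ {n} (a : B n) p q → a ^B (p ℕ.+ q) ≃ (a ^B p) *B (a ^B q)
^-+ a zero    q = ≃-sym (*-identityˡ (a ^B q))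
^-+ a (suc p) q = ≃-trans (*-congˡ a (^-+ a p q)) (≃-sym (*-assoc a (a ^B p) (a ^B q)))

Commute : ∀ {n} → B n → B n → Set
Commute a b = a *B b ≃ b *B a

Commute-sym : ∀ {n} (a b : B n) → Commute a b → Commute b a
Commute-sym a b = ≃-sym

Commute-^ : ∀ {n} (a b : B n) p → Commute a b → Commute (a ^B p) b
Commute-^ a b zero    c = ≃-trans (*-identityˡ b) (≃-sym (*-identityʳ b))
Commute-^ a b (suc p) c = begin
  (a *B (a ^B p)) *B b ≈⟨ *-assoc a (a ^B p) b ⟩
  a *B ((a ^B p) *B b) ≈⟨ *-congˡ a (Commute-^ a b p c) ⟩
  a *B (b *B (a ^B p)) ≈⟨ *-assoc a b (a ^B p) ⟨
  (a *B b) *B (a ^B p) ≈⟨ *-congʳ (a ^B p) c ⟩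
  (b *B a) *B (a ^B p) ≈⟨ *-assoc b a (a ^B p) ⟩
  b *B (a *B (a ^B p)) ∎
  where open ≃-Reasoning

^-distrib-* : ∀ {n} (a b : B n) p → Commute a b → (a *B b) ^B p ≃ (a ^B p) *B (b ^B p)
^-distrib-* a b zero    c = ≃-sym (*-identityˡ 1B)
^-distrib-* a b (suc p) c = begin
  (a *B b) *B ((a *B b) ^B p)         ≈⟨ *-congˡ (a *B b) (^-distrib-* a b p c) ⟩
  (a *B b) *B ((a ^B p) *B (b ^B p))  ≈⟨ *-assoc a b _ ⟩
  a *B (b *B ((a ^B p) *B (b ^B p)))  ≈⟨ *-congˡ a (*-assoc b (a ^B p) (b ^B p)) ⟨
  a *B ((b *B (a ^B p)) *B (b ^B p))  ≈⟨ *-congˡ a (*-congʳ (b ^B p) (Commute-^ a b p c)) ⟨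
  a *B (((a ^B p) *B b) *B (b ^B p))  ≈⟨ *-congˡ a (*-assoc (a ^B p) b (b ^B p)) ⟩
  a *B ((a ^B p) *B (b *B (b ^B p)))  ≈⟨ *-assoc a (a ^B p) _ ⟨
  (a *B (a ^B p)) *B (b *B (b ^B p))  ∎
  where open ≃-Reasoning

-- Two commuting elements: symmetric expressions in them are determined by
-- their sum and their product.  We use the power sums u^r + v^r, which obey
-- Newton's recursion, and the two-variable monomials u^p v^q + u^q v^p.

powerSum : ∀ {n} → B n → B n → ℕ → B n
powerSum u v r = (u ^B r) +B (v ^B r)

newton : ∀ {n} (u v : B n) → Commute u v → ∀ r →
  (u +B v) *B powerSum u v (suc r) ≃ powerSum u v (suc (suc r)) +B ((u *B v) *B powerSum u v r)
newton u v c r = begin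
  (u +B v) *B (U +B V)                                        ≈⟨ *-distribʳ u v (U +B V) ⟩
  (u *B (U +B V)) +B (v *B (U +B V))                          ≈⟨ +-cong (*-distribˡ u U V) (*-distribˡ v U V) ⟩
  ((u *B U) +B (u *B V)) +B ((v *B U) +B (v *B V))            ≈⟨ +-interchangeB (u *B U) (u *B V) (v *B U) (v *B V) ⟩
  ((u *B U) +B (v *B U)) +B ((u *B V) +B (v *B V))            ≈⟨ +-cong {a = (u *B U) +B (v *B U)} ≃-refl (+-comm (u *B V) (v *B V)) ⟩
  ((u *B U) +B (v *B U)) +B ((v *B V) +B (u *B V))            ≈⟨ +-interchangeB (u *B U) (v *B U) (v *B V) (u *B V) ⟩
  ((u *B U) +B (v *B V)) +B ((v *B U) +B (u *B V))            ≈⟨ +-cong {a = (u *B U) +B (v *B V)} ≃-refl (+-cong vU uV) ⟨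
  ((u *B U) +B (v *B V)) +B (((u *B v) *B (u ^B r)) +B ((u *B v) *B (v ^B r)))
    ≈⟨ +-cong {a = (u *B U) +B (v *B V)} ≃-refl (*-distribˡ (u *B v) (u ^B r) (v ^B r)) ⟨
  ((u *B U) +B (v *B V)) +B ((u *B v) *B powerSum u v r)      ∎
  where
  open ≃-Reasoning
  U = u ^B suc r
  V = v ^B suc r
  vU : (u *B v) *B (u ^B r) ≃ v *B U
  vU = begin
    (u *B v) *B (u ^B r) ≈⟨ *-assoc u v (u ^B r) ⟩
    u *B (v *B (u ^B r)) ≈⟨ *-congˡ u (Commute-^ u v r c) ⟨
    u *B ((u ^B r) *B v) ≈⟨ *-assoc u (u ^B r) v ⟨
    U *B v               ≈⟨ Commute-^ u v (suc r) c ⟩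
    v *B U               ∎
  uV : (u *B v) *B (v ^B r) ≃ u *B V
  uV = *-assoc u v (v ^B r)

module SameSumProduct {n} (u v u' v' : B n) (c : Commute u v) (c' : Commute u' v')
                      (sum≃ : u +B v ≃ u' +B v') (prod≃ : u *B v ≃ u' *B v') where

  -- Newton's recursion determines all power sums (induction on consecutive pairs).
  powerSums : ∀ r → (powerSum u v r ≃ powerSum u' v' r) × (powerSum u v (suc r) ≃ powerSum u' v' (suc r))
  powerSums zero = ≃-refl , ≃-trans (+-cong (*-identityʳ u) (*-identityʳ v))
                              (≃-trans sum≃ (≃-sym (+-cong (*-identityʳ u') (*-identityʳ v'))))
  powerSums (suc r) with powerSums r
  ... | h₀ , h₁ = h₁ , +-cancelʳ recursion (*-cong prod≃ h₀)
    where
    open ≃-Reasoning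
    recursion : powerSum u v (suc (suc r)) +B ((u *B v) *B powerSum u v r)
              ≃ powerSum u' v' (suc (suc r)) +B ((u' *B v') *B powerSum u' v' r)
    recursion = begin
      powerSum u v (suc (suc r)) +B ((u *B v) *B powerSum u v r)     ≈⟨ newton u v c r ⟨
      (u +B v) *B powerSum u v (suc r)                               ≈⟨ *-cong sum≃ h₁ ⟩
      (u' +B v') *B powerSum u' v' (suc r)                           ≈⟨ newton u' v' c' r ⟩
      powerSum u' v' (suc (suc r)) +B ((u' *B v') *B powerSum u' v' r) ∎

symMonomial : ∀ {n} → B n → B n → ℕ → ℕ → B n
symMonomial u v p q = ((u ^B p) *B (v ^B q)) +B ((u ^B q) *B (v ^B p))

symMonomial-factor : ∀ {n} (u v : B n) → Commute u v → ∀ p r →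
  symMonomial u v p (p ℕ.+ r) ≃ ((u *B v) ^B p) *B ((v ^B r) +B (u ^B r))
symMonomial-factor u v c p r = begin
  ((u ^B p) *B (v ^B (p ℕ.+ r))) +B ((u ^B (p ℕ.+ r)) *B (v ^B p)) ≈⟨ +-cong left right ⟩
  (UV *B (v ^B r)) +B (UV *B (u ^B r))                               ≈⟨ *-distribˡ UV (v ^B r) (u ^B r) ⟨
  UV *B ((v ^B r) +B (u ^B r))                                       ∎
  where
  open ≃-Reasoning
  UV = (u *B v) ^B p
  left : (u ^B p) *B (v ^B (p ℕ.+ r)) ≃ UV *B (v ^B r)
  left = begin
    (u ^B p) *B (v ^B (p ℕ.+ r))       ≈⟨ *-congˡ (u ^B p) (^-+ v p r) ⟩
    (u ^B p) *B ((v ^B p) *B (v ^B r)) ≈⟨ *-assoc (u ^B p) (v ^B p) (v ^B r) ⟨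
    ((u ^B p) *B (v ^B p)) *B (v ^B r) ≈⟨ *-congʳ (v ^B r) (^-distrib-* u v p c) ⟨
    UV *B (v ^B r)                     ∎
  uʳvᵖ : Commute (u ^B r) (v ^B p)
  uʳvᵖ = Commute-^ u (v ^B p) r (Commute-sym (v ^B p) u (Commute-^ v u p (Commute-sym u v c)))
  right : (u ^B (p ℕ.+ r)) *B (v ^B p) ≃ UV *B (u ^B r)
  right = begin
    (u ^B (p ℕ.+ r)) *B (v ^B p)       ≈⟨ *-congʳ (v ^B p) (^-+ u p r) ⟩
    ((u ^B p) *B (u ^B r)) *B (v ^B p) ≈⟨ *-assoc (u ^B p) (u ^B r) (v ^B p) ⟩
    (u ^B p) *B ((u ^B r) *B (v ^B p)) ≈⟨ *-congˡ (u ^B p) uʳvᵖ ⟩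
    (u ^B p) *B ((v ^B p) *B (u ^B r)) ≈⟨ *-assoc (u ^B p) (v ^B p) (u ^B r) ⟨
    ((u ^B p) *B (v ^B p)) *B (u ^B r) ≈⟨ *-congʳ (u ^B r) (^-distrib-* u v p c) ⟨
    UV *B (u ^B r)                     ∎

module SymMonomialDetermined {n} (u v u' v' : B n) (c : Commute u v) (c' : Commute u' v')
                             (sum≃ : u +B v ≃ u' +B v') (prod≃ : u *B v ≃ u' *B v') where
  open SameSumProduct u v u' v' c c' sum≃ prod≃

  ordered : ∀ p r → symMonomial u v p (p ℕ.+ r) ≃ symMonomial u' v' p (p ℕ.+ r)
  ordered p r = begin
    symMonomial u v p (p ℕ.+ r)                  ≈⟨ symMonomial-factor u v c p r ⟩
    ((u *B v) ^B p) *B ((v ^B r) +B (u ^B r))    ≈⟨ *-cong (^-cong p prod≃) sums ⟩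
    ((u' *B v') ^B p) *B ((v' ^B r) +B (u' ^B r)) ≈⟨ symMonomial-factor u' v' c' p r ⟨
    symMonomial u' v' p (p ℕ.+ r)                ∎
    where
    open ≃-Reasoning
    sums : (v ^B r) +B (u ^B r) ≃ (v' ^B r) +B (u' ^B r)
    sums = ≃-trans (+-comm (v ^B r) (u ^B r))
             (≃-trans (proj₁ (powerSums r)) (+-comm (u' ^B r) (v' ^B r)))

  symMonomial≃ : ∀ p q → symMonomial u v p q ≃ symMonomial u' v' p q
  symMonomial≃ p q with p ℕ.≤? q
  ... | yes p≤q = subst (λ z → symMonomial u v p z ≃ symMonomial u' v' p z)
                        (NP.m+[n∸m]≡n p≤q) (ordered p (q ℕ.∸ p))
  ... | no  p≰q = ≃-trans (+-comm ((u ^B p) *B (v ^B q)) ((u ^B q) *B (v ^B p))) (≃-trans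
                    (subst (λ z → symMonomial u v q z ≃ symMonomial u' v' q z)
                           (NP.m+[n∸m]≡n q≤p) (ordered q (p ℕ.∸ q)))
                    (+-comm ((u' ^B q) *B (v' ^B p)) ((u' ^B p) *B (v' ^B q))))
    where q≤p = NP.<⇒≤ (NP.≰⇒> p≰q)

actPP-resp : ∀ {n} (τ : Permutation′ n) {y y' : PP n} → y ≐ y' → actPP τ y ≐ actPP τ y'
actPP-resp τ {σ , d} {σ' , d'} (p , q) =
  (λ i → cong (τ ⟨$⟩ʳ_) (p (τ ⟨$⟩ˡ i))) ,
  (λ i → trans (VecP.lookup∘tabulate _ i)
           (trans (q (τ ⟨$⟩ˡ i)) (sym (VecP.lookup∘tabulate _ i))))

actPP-mul : ∀ {n} (τ : Permutation′ n) (y z : PP n) →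
  actPP τ (mulPP y z) ≐ mulPP (actPP τ y) (actPP τ z)
actPP-mul τ (σ , d) (ρ , e) =
  (λ i → cong (λ k → τ ⟨$⟩ʳ (σ ⟨$⟩ʳ k)) (sym (inverseˡ τ))) ,
  (λ i → begin
    lookup (tabulate (λ k → lookup (d ∪ e) (τ ⟨$⟩ˡ k))) i       ≡⟨ VecP.lookup∘tabulate _ i ⟩
    lookup (d ∪ e) (τ ⟨$⟩ˡ i)                                   ≡⟨ lookup-∪ d e (τ ⟨$⟩ˡ i) ⟩
    lookup d (τ ⟨$⟩ˡ i) ∨ lookup e (τ ⟨$⟩ˡ i)
      ≡⟨ cong₂ _∨_ (VecP.lookup∘tabulate _ i) (VecP.lookup∘tabulate _ i) ⟨
    lookup (τd) i ∨ lookup (τe) i                               ≡⟨ lookup-∪ τd τe i ⟨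
    lookup (τd ∪ τe) i                                          ∎)
  where
  open ≡-Reasoning
  τd = tabulate (λ k → lookup d (τ ⟨$⟩ˡ k))
  τe = tabulate (λ k → lookup e (τ ⟨$⟩ˡ k))

actPP-e₀ : ∀ {n} (τ : Permutation′ n) → actPP τ e₀ ≐ e₀
actPP-e₀ {n} τ =
  (λ i → inverseʳ τ) ,
  (λ i → trans (VecP.lookup∘tabulate _ i) (trans (lookup-∅ (τ ⟨$⟩ˡ i)) (sym (lookup-∅ i))))

actPP-∘ : ∀ {n} (τ ρ : Permutation′ n) (y : PP n) → actPP τ (actPP ρ y) ≐ actPP (ρ ∘ₚ τ) y
actPP-∘ τ ρ (σ , d) =
  (λ i → refl) ,
  (λ i → trans (VecP.lookup∘tabulate _ i)
           (trans (VecP.lookup∘tabulate _ (τ ⟨$⟩ˡ i)) (sym (VecP.lookup∘tabulate _ i))))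

inverse-pointwise : ∀ {n} (τ τ' : Permutation′ n) → τ ≈ₚ τ' → ∀ i → τ ⟨$⟩ˡ i ≡ τ' ⟨$⟩ˡ i
inverse-pointwise τ τ' p i =
  trans (sym (inverseˡ τ')) (cong (τ' ⟨$⟩ˡ_) (trans (sym (p (τ ⟨$⟩ˡ i))) (inverseʳ τ)))

actPP-pointwise : ∀ {n} (τ τ' : Permutation′ n) → τ ≈ₚ τ' → (y : PP n) → actPP τ y ≐ actPP τ' y
actPP-pointwise τ τ' p (σ , d) =
  (λ i → trans (p _) (cong (λ k → τ' ⟨$⟩ʳ (σ ⟨$⟩ʳ k)) (inverse-pointwise τ τ' p i))) ,
  (λ i → trans (VecP.lookup∘tabulate _ i)
           (trans (cong (lookup d) (inverse-pointwise τ τ' p i)) (sym (VecP.lookup∘tabulate _ i))))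

Lin-act : ∀ {n} (g : PP n → ℚ) (τ : Permutation′ n) (a : B n) →
  Lin g (act τ a) ≡ Lin (λ y → g (actPP τ y)) a
Lin-act g τ []            = refl
Lin-act g τ ((c , y) ∷ a) = cong (c Q.* g (actPP τ y) Q.+_) (Lin-act g τ a)

act-cong : ∀ {n} (τ : Permutation′ n) {a a' : B n} → a ≃ a' → act τ a ≃ act τ a'
act-cong τ {a} {a'} e = functionally λ g rg →
  trans (Lin-act g τ a) (trans (agree e _ (λ r → rg (actPP-resp τ r))) (sym (Lin-act g τ a')))

act-* : ∀ {n} (τ : Permutation′ n) (a b : B n) → act τ (a *B b) ≃ act τ a *B act τ b
act-* τ a b = functionally λ g rg → begin
  Lin g (act τ (a *B b))                                               ≡⟨ Lin-act g τ (a *B b) ⟩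
  Lin (λ y → g (actPP τ y)) (a *B b)                                   ≡⟨ Lin-* _ a b ⟩
  Lin (λ y → Lin (λ z → g (actPP τ (mulPP y z))) b) a
    ≡⟨ Lin-cong a (λ y → Lin-cong b (λ z → rg (actPP-mul τ y z))) ⟩
  Lin (λ y → Lin (λ z → g (mulPP (actPP τ y) (actPP τ z))) b) a        ≡⟨ Lin-cong a (λ y → Lin-act _ τ b) ⟨
  Lin (λ y → Lin (λ z → g (mulPP (actPP τ y) z)) (act τ b)) a          ≡⟨ Lin-act _ τ a ⟨
  Lin (λ y → Lin (λ z → g (mulPP y z)) (act τ b)) (act τ a)            ≡⟨ Lin-* g (act τ a) (act τ b) ⟨
  Lin g (act τ a *B act τ b)                                           ∎
  where open ≡-Reasoning

act-+ : ∀ {n} (τ : Permutation′ n) (a b : B n) → act τ (a +B b) ≃ act τ a +B act τ b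
act-+ τ a b = ≃-reflexive (ListP.map-++ _ a b)

act-· : ∀ {n} (τ : Permutation′ n) (c : ℚ) (a : B n) → act τ (c ·B a) ≃ c ·B act τ a
act-· τ c a = functionally λ g rg →
  trans (Lin-act g τ (c ·B a)) (trans (Lin-· _ c a)
    (trans (cong (c Q.*_) (sym (Lin-act g τ a))) (sym (Lin-· g c (act τ a)))))

act-1 : ∀ {n} (τ : Permutation′ n) → act τ (1B {n}) ≃ 1B
act-1 τ = functionally λ g rg →
  trans (Lin-act g τ 1B) (trans (Lin-1B (λ y → g (actPP τ y))) (trans (rg (actPP-e₀ τ)) (sym (Lin-1B g))))

act-∘ : ∀ {n} (τ ρ : Permutation′ n) (a : B n) → act τ (act ρ a) ≃ act (ρ ∘ₚ τ) a
act-∘ τ ρ a = functionally λ g rg →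
  trans (Lin-act g τ (act ρ a)) (trans (Lin-act _ ρ a)
    (trans (Lin-cong a (λ y → rg (actPP-∘ τ ρ y))) (sym (Lin-act g (ρ ∘ₚ τ) a))))

act-pointwise : ∀ {n} (τ τ' : Permutation′ n) → τ ≈ₚ τ' → (a : B n) → act τ a ≃ act τ' a
act-pointwise τ τ' p a = functionally λ g rg →
  trans (Lin-act g τ a) (trans (Lin-cong a (λ y → rg (actPP-pointwise τ τ' p y))) (sym (Lin-act g τ' a)))

act-id : ∀ {n} (a : B n) → act id a ≃ a
act-id a = functionally λ g rg → trans (Lin-act g id a) (Lin-cong a (λ y → rg (fixed y)))
  where
  fixed : ∀ y → actPP id y ≐ y
  fixed (σ , d) = (λ i → refl) , (λ i → VecP.lookup∘tabulate _ i)

transpose-left : ∀ {n} (i j : Fin n) → transpose i j ⟨$⟩ʳ i ≡ j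
transpose-left i j rewrite dec-true (i FinP.≟ i) refl = refl

transpose-right : ∀ {n} (i j : Fin n) → transpose i j ⟨$⟩ʳ j ≡ i
transpose-right i j with j FinP.≟ i
... | yes e  = e
... | no  ne rewrite dec-true (j FinP.≟ j) refl = refl

transpose-other : ∀ {n} (i j k : Fin n) → k ≢ i → k ≢ j → transpose i j ⟨$⟩ʳ k ≡ k
transpose-other i j k ni nj rewrite dec-false (k FinP.≟ i) ni | dec-false (k FinP.≟ j) nj = refl

transpose-same : ∀ {n} (i : Fin n) → transpose i i ≈ₚ id
transpose-same i k = cases (k FinP.≟ i)
  where
  cases : Dec (k ≡ i) → transpose i i ⟨$⟩ʳ k ≡ k
  cases (yes refl) = transpose-left k k
  cases (no ne)    = transpose-other i i k ne ne

transpose-comm : ∀ {n} (i j : Fin n) → transpose i j ≈ₚ transpose j i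
transpose-comm i j k = cases (k FinP.≟ i) (k FinP.≟ j)
  where
  cases : Dec (k ≡ i) → Dec (k ≡ j) → transpose i j ⟨$⟩ʳ k ≡ transpose j i ⟨$⟩ʳ k
  cases (yes refl) _        = trans (transpose-left k j) (sym (transpose-right j k))
  cases (no _)     (yes refl) = trans (transpose-right i k) (sym (transpose-left k i))
  cases (no ki)    (no kj)    = trans (transpose-other i j k ki kj) (sym (transpose-other j i k kj ki))

transpose-involutive : ∀ {n} (i j k : Fin n) → transpose i j ⟨$⟩ʳ (transpose i j ⟨$⟩ʳ k) ≡ k
transpose-involutive i j k = trans (cong (transpose i j ⟨$⟩ʳ_) (transpose-comm i j k))
                                   (inverseʳ (transpose i j))

transpose-conj : ∀ {n} (τ : Permutation′ n) (a b k : Fin n) →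
  τ ⟨$⟩ʳ (transpose a b ⟨$⟩ʳ (τ ⟨$⟩ˡ k)) ≡ transpose (τ ⟨$⟩ʳ a) (τ ⟨$⟩ʳ b) ⟨$⟩ʳ k
transpose-conj τ a b k = cases ((τ ⟨$⟩ˡ k) FinP.≟ a) ((τ ⟨$⟩ˡ k) FinP.≟ b)
  where
  t = transpose (τ ⟨$⟩ʳ a) (τ ⟨$⟩ʳ b)
  image : ∀ {c} → τ ⟨$⟩ˡ k ≡ c → k ≡ τ ⟨$⟩ʳ c
  image e = trans (sym (inverseʳ τ)) (cong (τ ⟨$⟩ʳ_) e)
  cases : Dec (τ ⟨$⟩ˡ k ≡ a) → Dec (τ ⟨$⟩ˡ k ≡ b) →
          τ ⟨$⟩ʳ (transpose a b ⟨$⟩ʳ (τ ⟨$⟩ˡ k)) ≡ t ⟨$⟩ʳ k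
  cases (yes e) _ =
    trans (cong (λ z → τ ⟨$⟩ʳ (transpose a b ⟨$⟩ʳ z)) e) (trans (cong (τ ⟨$⟩ʳ_) (transpose-left a b))
      (sym (trans (cong (t ⟨$⟩ʳ_) (image e)) (transpose-left (τ ⟨$⟩ʳ a) (τ ⟨$⟩ʳ b)))))
  cases (no _) (yes e) =
    trans (cong (λ z → τ ⟨$⟩ʳ (transpose a b ⟨$⟩ʳ z)) e) (trans (cong (τ ⟨$⟩ʳ_) (transpose-right a b))
      (sym (trans (cong (t ⟨$⟩ʳ_) (image e)) (transpose-right (τ ⟨$⟩ʳ a) (τ ⟨$⟩ʳ b)))))
  cases (no na) (no nb) =
    trans (cong (τ ⟨$⟩ʳ_) (transpose-other a b _ na nb)) (trans (inverseʳ τ)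
      (sym (transpose-other _ _ k (λ e → na (preimage e)) (λ e → nb (preimage e)))))
    where preimage : ∀ {c} → k ≡ τ ⟨$⟩ʳ c → τ ⟨$⟩ˡ k ≡ c
          preimage e = trans (cong (τ ⟨$⟩ˡ_) e) (inverseˡ τ)

Adjacent : ∀ {n} → Fin n → Fin n → Set
Adjacent I J = toℕ J ≡ suc (toℕ I)

module AdjacentGeneration {n} (H : Permutation′ n → Set)
  (H-pointwise : ∀ τ τ' → τ ≈ₚ τ' → H τ → H τ')
  (H-id : H id)
  (H-∘ : ∀ {τ ρ} → H τ → H ρ → H (τ ∘ₚ ρ))
  (H-adjacent : ∀ (k k' : Fin n) → Adjacent k k' → H (transpose k k')) where

  -- (q p) with p = q + d: conjugate (q p-1) by the adjacent (p-1 p).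
  H-transpose : ∀ d (q p : Fin n) → toℕ q ℕ.+ d ≡ toℕ p → H (transpose q p)
  H-transpose zero q p e
    rewrite FinP.toℕ-injective (trans (sym (NP.+-identityʳ (toℕ q))) e) =
    H-pointwise id (transpose p p) (λ k → sym (transpose-same p k)) H-id
  H-transpose (suc zero) q p e = H-adjacent q p (trans (sym e) (NP.+-comm (toℕ q) 1))
  H-transpose (suc (suc d)) q p e =
    H-pointwise _ (transpose q p) conjugate (H-∘ hs (H-∘ (H-transpose (suc d) q p' (sym toℕp')) hs))
    where
    q+d+1<n : toℕ q ℕ.+ suc d ℕ.< n
    q+d+1<n = NP.<-trans (subst (toℕ q ℕ.+ suc d ℕ.<_) e (NP.+-monoʳ-< (toℕ q) (NP.n<1+n (suc d))))
                         (FinP.toℕ<n p)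
    p' : Fin n
    p' = Fin.fromℕ< q+d+1<n
    toℕp' : toℕ p' ≡ toℕ q ℕ.+ suc d
    toℕp' = FinP.toℕ-fromℕ< q+d+1<n
    s = transpose p' p
    hs : H s
    hs = H-adjacent p' p (trans (sym e) (trans (NP.+-suc (toℕ q) (suc d)) (cong suc (sym toℕp'))))
    q≢p' : q ≢ p'
    q≢p' eq = NP.m≢1+m+n (toℕ q) (trans (trans (cong toℕ eq) toℕp') (NP.+-suc (toℕ q) d))
    q≢p : q ≢ p
    q≢p eq = NP.m≢1+m+n (toℕ q) (trans (trans (cong toℕ eq) (sym e)) (NP.+-suc (toℕ q) (suc d)))
    -- s is an involution, so s (q p') s = s (q p') s⁻¹ = (s q  s p') = (q p).
    conjugate : s ∘ₚ (transpose q p' ∘ₚ s) ≈ₚ transpose q p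
    conjugate k = begin
      s ⟨$⟩ʳ (transpose q p' ⟨$⟩ʳ (s ⟨$⟩ʳ k))
        ≡⟨ cong (λ z → s ⟨$⟩ʳ (transpose q p' ⟨$⟩ʳ z)) (transpose-comm p' p k) ⟩
      s ⟨$⟩ʳ (transpose q p' ⟨$⟩ʳ (s ⟨$⟩ˡ k))   ≡⟨ transpose-conj s q p' k ⟩
      transpose (s ⟨$⟩ʳ q) (s ⟨$⟩ʳ p') ⟨$⟩ʳ k   ≡⟨ cong₂ (λ x y → transpose x y ⟨$⟩ʳ k)
                                                       (transpose-other p' p q q≢p' q≢p) (transpose-left p' p) ⟩
      transpose q p ⟨$⟩ʳ k                      ∎
      where open ≡-Reasoning

  H-transposition : ∀ (i j : Fin n) → H (transpose i j)
  H-transposition i j with toℕ i ℕ.≤? toℕ j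
  ... | yes i≤j = H-transpose (toℕ j ℕ.∸ toℕ i) i j (NP.m+[n∸m]≡n i≤j)
  ... | no  i≰j = H-pointwise (transpose j i) (transpose i j) (transpose-comm j i)
                    (H-transpose (toℕ i ℕ.∸ toℕ j) j i (NP.m+[n∸m]≡n (NP.<⇒≤ (NP.≰⇒> i≰j))))

  H-eval : ∀ (ts : TranspositionList n) → H (eval ts)
  H-eval []             = H-id
  H-eval ((i , j) ∷ ts) = H-∘ (H-transposition i j) (H-eval ts)

  H-all : ∀ τ → H τ
  H-all τ = H-pointwise (eval (decompose τ)) τ (eval-decompose τ) (H-eval (decompose τ))

fixed-by-adjacent⇒fixed : ∀ {n} (a : B n) → (∀ k k' → Adjacent k k' → act (transpose k k') a ≃ a) →
  ∀ τ → act τ a ≃ a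
fixed-by-adjacent⇒fixed a adjacent = AdjacentGeneration.H-all (λ σ → act σ a ≃ a)
  (λ σ σ' p h → ≃-trans (≃-sym (act-pointwise σ σ' p a)) h)
  (act-id a)
  (λ {σ} {ρ} hσ hρ → ≃-trans (≃-sym (act-∘ ρ σ a)) (≃-trans (act-cong ρ hσ) hρ))
  adjacent

sum-extract : ∀ {n} (f : Fin n → ℚ) (c : Fin n) →
  sum f ≡ f c Q.+ sum (λ j → if does (j FinP.≟ c) then 0ℚ else f j)
sum-extract {suc n} f Fin.zero =
  cong (f Fin.zero Q.+_) (sym (QP.+-identityˡ (sum (λ j → f (Fin.suc j)))))
sum-extract {suc n} f (Fin.suc c) = begin
  f Fin.zero Q.+ sum (λ j → f (Fin.suc j))            ≡⟨ cong (f Fin.zero Q.+_) (sum-extract (λ j → f (Fin.suc j)) c) ⟩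
  f Fin.zero Q.+ (f (Fin.suc c) Q.+ rest)             ≡⟨ sym (QP.+-assoc (f Fin.zero) (f (Fin.suc c)) rest) ⟩
  (f Fin.zero Q.+ f (Fin.suc c)) Q.+ rest             ≡⟨ cong (Q._+ rest) (QP.+-comm (f Fin.zero) (f (Fin.suc c))) ⟩
  (f (Fin.suc c) Q.+ f Fin.zero) Q.+ rest             ≡⟨ QP.+-assoc (f (Fin.suc c)) (f Fin.zero) rest ⟩
  f (Fin.suc c) Q.+ (f Fin.zero Q.+ rest)             ∎
  where
  open ≡-Reasoning
  rest = sum (λ j → if does (j FinP.≟ c) then 0ℚ else f (Fin.suc j))

sum-diagonal : ∀ {n} (X : Fin n → Fin n → ℚ) →
  sum (λ j → sum (λ l → X j l))
    ≡ sum (λ j → sum (λ l → if does (l FinP.≟ j) then 0ℚ else X j l)) Q.+ sum (λ j → X j j)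
sum-diagonal X =
  trans (sum-cong-≗ (λ j → trans (sum-extract (X j) j) (QP.+-comm (X j j) _)))
        (∑-distrib-+ (λ j → sum (λ l → if does (l FinP.≟ j) then 0ℚ else X j l)) (λ j → X j j))

eqᵇ : ∀ {n} → Fin n → Fin n → Bool
eqᵇ k a = does (k FinP.≟ a)

sum-δ : ∀ {n} (c : Fin n) (h : Fin n → ℚ) → sum (λ j → ind (eqᵇ j c) Q.* h j) ≡ h c
sum-δ {n} c h =
  trans (sum-extract (λ j → ind (eqᵇ j c) Q.* h j) c)
    (trans (cong₂ Q._+_ (trans (cong (λ b → ind b Q.* h c) (dec-true (c FinP.≟ c) refl)) (QP.*-identityˡ (h c)))
                        (trans (sum-cong-≗ vanish) (sum-replicate-zero n)))
           (QP.+-identityʳ (h c)))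
  where
  vanish : ∀ j → (if eqᵇ j c then 0ℚ else ind (eqᵇ j c) Q.* h j) ≡ 0ℚ
  vanish j with eqᵇ j c
  ... | true  = refl
  ... | false = QP.*-zeroˡ (h j)

sum-split-point : ∀ {n} (P' P : Fin n → Bool) (c : Fin n) (h : Fin n → ℚ) →
  (∀ j → ind (P' j) ≡ ind (P j) Q.+ ind (eqᵇ j c)) →
  sum (λ j → ind (P' j) Q.* h j) ≡ sum (λ j → ind (P j) Q.* h j) Q.+ h c
sum-split-point P' P c h e =
  trans (sum-cong-≗ (λ j → trans (cong (Q._* h j) (e j)) (QP.*-distribʳ-+ (h j) (ind (P j)) (ind (eqᵇ j c)))))
    (trans (∑-distrib-+ (λ j → ind (P j) Q.* h j) (λ j → ind (eqᵇ j c) Q.* h j))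
           (cong (sum (λ j → ind (P j) Q.* h j) Q.+_) (sum-δ c h)))

guarded-cong : ∀ (b : Bool) {x y : ℚ} → (b ≡ true → x ≡ y) → ind b Q.* x ≡ ind b Q.* y
guarded-cong true  f         = cong (1ℚ Q.*_) (f refl)
guarded-cong false {x} {y} f = trans (QP.*-zeroˡ x) (sym (QP.*-zeroˡ y))

sum-guarded-cong : ∀ {n} (P : Fin n → Bool) {X Y : Fin n → ℚ} → (∀ j → P j ≡ true → X j ≡ Y j) →
  sum (λ j → ind (P j) Q.* X j) ≡ sum (λ j → ind (P j) Q.* Y j)
sum-guarded-cong P f = sum-cong-≗ (λ j → guarded-cong (P j) (f j))

below : ∀ {n} → Fin n → Fin n → Bool
below j k = toℕ j ℕ.<ᵇ toℕ k

below⇒< : ∀ {n} {j k : Fin n} → below j k ≡ true → toℕ j ℕ.< toℕ k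
below⇒< {j = j} {k} e = NP.<ᵇ⇒< (toℕ j) (toℕ k) (subst T (sym e) tt)

<⇒below : ∀ {n} {j k : Fin n} → toℕ j ℕ.< toℕ k → below j k ≡ true
<⇒below {j = j} {k} p with below j k in e | NP.<⇒<ᵇ p
... | true | _ = refl

≮⇒below : ∀ {n} {j k : Fin n} → ¬ (toℕ j ℕ.< toℕ k) → below j k ≡ false
≮⇒below {j = j} {k} np with below j k in e
... | true  = ⊥-elim (np (below⇒< e))
... | false = refl

below-cong : ∀ {n} {j k j' k' : Fin n} →
  (toℕ j ℕ.< toℕ k → toℕ j' ℕ.< toℕ k') → (toℕ j' ℕ.< toℕ k' → toℕ j ℕ.< toℕ k) → below j k ≡ below j' k'
below-cong {j = j} {k} {j'} {k'} f g with below j k in e₁ | below j' k' in e₂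
... | true  | true  = refl
... | false | false = refl
... | true  | false with () ← trans (sym e₂) (<⇒below (f (below⇒< e₁)))
... | false | true  with () ← trans (sym e₁) (<⇒below (g (below⇒< e₂)))

<⇒≢ : ∀ {n} {j k : Fin n} → toℕ j ℕ.< toℕ k → j ≢ k
<⇒≢ p refl = NP.<-irrefl refl p

swapPP : ∀ {n} → Fin n → Fin n → PP n
swapPP j k = (transpose j k , ⁅ j ⁆ ∪ ⁅ k ⁆)

Lin-filter-tabulate : ∀ {n m k} (g : PP n → ℚ) (F : Fin k → PP n) (P : Fin k → Bool) (h : Fin m → Fin k) →
  Lin g (map (λ j → (1ℚ , F j)) (filterᵇ P (List.tabulate h))) ≡ sum (λ j → ind (P (h j)) Q.* g (F (h j)))
Lin-filter-tabulate {m = zero}  g F P h = refl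
Lin-filter-tabulate {m = suc m} g F P h with P (h Fin.zero)
... | true  = cong (1ℚ Q.* g (F (h Fin.zero)) Q.+_) (Lin-filter-tabulate g F P (λ j → h (Fin.suc j)))
... | false = trans (Lin-filter-tabulate g F P (λ j → h (Fin.suc j)))
                (sym (trans (cong (Q._+ rest) (QP.*-zeroˡ (g (F (h Fin.zero))))) (QP.+-identityˡ rest)))
  where rest = sum (λ j → ind (P (h (Fin.suc j))) Q.* g (F (h (Fin.suc j))))

Lin-ξ : ∀ {n} (g : PP n → ℚ) (k : Fin n) → Lin g (ξ k) ≡ sum (λ j → ind (below j k) Q.* g (swapPP j k))
Lin-ξ g k = Lin-filter-tabulate g (λ j → swapPP j k) (λ j → below j k) (λ j → j)

lookup-⁅⁆ : ∀ {n} (a k : Fin n) → lookup ⁅ a ⁆ k ≡ eqᵇ k a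
lookup-⁅⁆ Fin.zero    Fin.zero    = refl
lookup-⁅⁆ Fin.zero    (Fin.suc k) = lookup-∅ k
lookup-⁅⁆ (Fin.suc a) Fin.zero    = refl
lookup-⁅⁆ (Fin.suc a) (Fin.suc k) = lookup-⁅⁆ a k

lookup-swapPP : ∀ {n} (a b k : Fin n) → lookup (proj₂ (swapPP a b)) k ≡ (eqᵇ k a ∨ eqᵇ k b)
lookup-swapPP a b k = trans (lookup-∪ ⁅ a ⁆ ⁅ b ⁆ k) (cong₂ _∨_ (lookup-⁅⁆ a k) (lookup-⁅⁆ b k))

swapPP-sym : ∀ {n} (a b : Fin n) → swapPP a b ≐ swapPP b a
swapPP-sym a b =
  transpose-comm a b ,
  (λ k → trans (lookup-swapPP a b k) (trans (BoolP.∨-comm (eqᵇ k a) (eqᵇ k b)) (sym (lookup-swapPP b a k))))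

does-cong : ∀ {A B : Set} (p : Dec A) (q : Dec B) → (A → B) → (B → A) → does p ≡ does q
does-cong (yes a) (yes b) f g = refl
does-cong (yes a) (no nb) f g = ⊥-elim (nb (f a))
does-cong (no na) (yes b) f g = ⊥-elim (na (g b))
does-cong (no na) (no nb) f g = refl

swapPP-act : ∀ {n} (τ : Permutation′ n) (a b : Fin n) → actPP τ (swapPP a b) ≐ swapPP (τ ⟨$⟩ʳ a) (τ ⟨$⟩ʳ b)
swapPP-act τ a b =
  transpose-conj τ a b ,
  (λ k → trans (VecP.lookup∘tabulate _ k)
    (trans (lookup-swapPP a b (τ ⟨$⟩ˡ k))
      (trans (cong₂ _∨_ (moved a) (moved b)) (sym (lookup-swapPP (τ ⟨$⟩ʳ a) (τ ⟨$⟩ʳ b) k)))))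
  where
  moved : ∀ c {k} → eqᵇ (τ ⟨$⟩ˡ k) c ≡ eqᵇ k (τ ⟨$⟩ʳ c)
  moved c {k} = does-cong ((τ ⟨$⟩ˡ k) FinP.≟ c) (k FinP.≟ (τ ⟨$⟩ʳ c))
    (λ e → trans (sym (inverseʳ τ)) (cong (τ ⟨$⟩ʳ_) e))
    (λ e → trans (cong (τ ⟨$⟩ˡ_) e) (inverseˡ τ))

transpose-conjugate : ∀ {n} (a b c d x : Fin n) → let τ = transpose a b in
  τ ⟨$⟩ʳ (transpose c d ⟨$⟩ʳ x) ≡ transpose (τ ⟨$⟩ʳ c) (τ ⟨$⟩ʳ d) ⟨$⟩ʳ (τ ⟨$⟩ʳ x)
transpose-conjugate a b c d x =
  trans (cong (λ z → τ ⟨$⟩ʳ (transpose c d ⟨$⟩ʳ z)) (sym (inverseˡ τ {x}))) (transpose-conj τ c d (τ ⟨$⟩ʳ x))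
  where τ = transpose a b

absorb : ∀ {n} (a b c k : Fin n) →
  (eqᵇ k a ∨ eqᵇ k b) ∨ eqᵇ k c ≡ (eqᵇ k a ∨ eqᵇ k b) ∨ eqᵇ k (transpose a b ⟨$⟩ʳ c)
absorb a b c k = cases (c FinP.≟ a) (c FinP.≟ b)
  where
  open ∨-Solver using (prove; var; _⊕_)
  ka = eqᵇ k a
  kb = eqᵇ k b
  cases : Dec (c ≡ a) → Dec (c ≡ b) → (ka ∨ kb) ∨ eqᵇ k c ≡ (ka ∨ kb) ∨ eqᵇ k (transpose a b ⟨$⟩ʳ c)
  cases (yes refl) _ rewrite transpose-left c b =
    prove 2 ((var Fin.zero ⊕ var (Fin.suc Fin.zero)) ⊕ var Fin.zero)
            ((var Fin.zero ⊕ var (Fin.suc Fin.zero)) ⊕ var (Fin.suc Fin.zero)) (ka Vec.∷ kb Vec.∷ Vec.[])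
  cases (no _) (yes refl) rewrite transpose-right a c =
    prove 2 ((var Fin.zero ⊕ var (Fin.suc Fin.zero)) ⊕ var (Fin.suc Fin.zero))
            ((var Fin.zero ⊕ var (Fin.suc Fin.zero)) ⊕ var Fin.zero) (ka Vec.∷ kb Vec.∷ Vec.[])
  cases (no ca) (no cb) rewrite transpose-other a b c ca cb = refl

swapPP-exchange-domain : ∀ {n} (a b c d k : Fin n) → let τ = transpose a b in
  (eqᵇ k a ∨ eqᵇ k b) ∨ (eqᵇ k c ∨ eqᵇ k d)
    ≡ (eqᵇ k (τ ⟨$⟩ʳ c) ∨ eqᵇ k (τ ⟨$⟩ʳ d)) ∨ (eqᵇ k a ∨ eqᵇ k b)
swapPP-exchange-domain a b c d k = begin
  ab ∨ (eqᵇ k c ∨ eqᵇ k d)                                 ≡⟨ spread ab (eqᵇ k c) (eqᵇ k d) ⟩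
  (ab ∨ eqᵇ k c) ∨ (ab ∨ eqᵇ k d)                          ≡⟨ cong₂ _∨_ (absorb a b c k) (absorb a b d k) ⟩
  (ab ∨ eqᵇ k (τ ⟨$⟩ʳ c)) ∨ (ab ∨ eqᵇ k (τ ⟨$⟩ʳ d))
    ≡⟨ spread′ ab (eqᵇ k (τ ⟨$⟩ʳ c)) (eqᵇ k (τ ⟨$⟩ʳ d)) ⟩
  (eqᵇ k (τ ⟨$⟩ʳ c) ∨ eqᵇ k (τ ⟨$⟩ʳ d)) ∨ ab              ∎
  where
  open ≡-Reasoning
  open ∨-Solver using (prove; var; _⊕_; Expr)
  τ = transpose a b
  ab = eqᵇ k a ∨ eqᵇ k b
  x y z : Expr 3
  x = var Fin.zero
  y = var (Fin.suc Fin.zero)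
  z = var (Fin.suc (Fin.suc Fin.zero))
  spread : ∀ p q r → p ∨ (q ∨ r) ≡ (p ∨ q) ∨ (p ∨ r)
  spread p q r = prove 3 (x ⊕ (y ⊕ z)) ((x ⊕ y) ⊕ (x ⊕ z)) (p Vec.∷ q Vec.∷ r Vec.∷ Vec.[])
  spread′ : ∀ p q r → (p ∨ q) ∨ (p ∨ r) ≡ (q ∨ r) ∨ p
  spread′ p q r = prove 3 ((x ⊕ y) ⊕ (x ⊕ z)) ((y ⊕ z) ⊕ x) (p Vec.∷ q Vec.∷ r Vec.∷ Vec.[])

lookup-swapPP² : ∀ {n} (a b c d k : Fin n) →
  lookup (proj₂ (mulPP (swapPP a b) (swapPP c d))) k ≡ (eqᵇ k a ∨ eqᵇ k b) ∨ (eqᵇ k c ∨ eqᵇ k d)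
lookup-swapPP² a b c d k =
  trans (lookup-∪ (⁅ a ⁆ ∪ ⁅ b ⁆) (⁅ c ⁆ ∪ ⁅ d ⁆) k) (cong₂ _∨_ (lookup-swapPP a b k) (lookup-swapPP c d k))

swapPP-exchange : ∀ {n} (a b c d : Fin n) → let τ = transpose a b in
  mulPP (swapPP a b) (swapPP c d) ≐ mulPP (swapPP (τ ⟨$⟩ʳ c) (τ ⟨$⟩ʳ d)) (swapPP a b)
swapPP-exchange a b c d =
  transpose-conjugate a b c d ,
  (λ k → trans (lookup-swapPP² a b c d k)
           (trans (swapPP-exchange-domain a b c d k) (sym (lookup-swapPP² _ _ a b k))))

swapPP-exchange′ : ∀ {n} (a b c d c' d' : Fin n) →
  transpose a b ⟨$⟩ʳ c ≡ c' → transpose a b ⟨$⟩ʳ d ≡ d' →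
  mulPP (swapPP a b) (swapPP c d) ≐ mulPP (swapPP c' d') (swapPP a b)
swapPP-exchange′ a b c d c' d' e₁ e₂ =
  ≐-trans (swapPP-exchange a b c d) (≐-reflexive (cong₂ (λ x y → mulPP (swapPP x y) (swapPP a b)) e₁ e₂))

-- ξ_b commutes with every transposition (j a) of points below b:
-- conjugation by (j a) permutes the summands of ξ_b.
ξ-centralises : ∀ {n} (j a b : Fin n) → toℕ j ℕ.< toℕ b → toℕ a ℕ.< toℕ b →
  ∀ (g : PP n → ℚ) → Respectful g →
  Lin (λ z → g (mulPP (swapPP j a) z)) (ξ b) ≡ Lin (λ z → g (mulPP z (swapPP j a))) (ξ b)
ξ-centralises {n} j a b j<b a<b g rg = begin
  Lin (λ z → g (mulPP (swapPP j a) z)) (ξ b)                 ≡⟨ Lin-ξ _ b ⟩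
  sum (λ l → ind (below l b) Q.* g (mulPP (swapPP j a) (swapPP l b)))
    ≡⟨ sum-cong-≗ (λ l → cong₂ (λ x y → ind x Q.* y) (sym (below-moved l)) (rg (exchange l))) ⟩
  sum (λ l → ind (below (t l) b) Q.* g (mulPP (swapPP (t l) b) (swapPP j a)))
    ≡⟨ sum-permute (λ l → ind (below l b) Q.* g (mulPP (swapPP l b) (swapPP j a))) (transpose j a) ⟨
  sum (λ l → ind (below l b) Q.* g (mulPP (swapPP l b) (swapPP j a))) ≡⟨ Lin-ξ _ b ⟨
  Lin (λ z → g (mulPP z (swapPP j a))) (ξ b)                 ∎
  where
  open ≡-Reasoning
  t : Fin n → Fin n
  t l = transpose j a ⟨$⟩ʳ l
  exchange : ∀ l → mulPP (swapPP j a) (swapPP l b) ≐ mulPP (swapPP (t l) b) (swapPP j a)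
  exchange l = swapPP-exchange′ j a l b (t l) b refl
                 (transpose-other j a b (λ e → <⇒≢ j<b (sym e)) (λ e → <⇒≢ a<b (sym e)))
  below-moved : ∀ l → below (t l) b ≡ below l b
  below-moved l = cases (l FinP.≟ j) (l FinP.≟ a)
    where
    cases : Dec (l ≡ j) → Dec (l ≡ a) → below (t l) b ≡ below l b
    cases (yes refl) _ rewrite transpose-left l a = trans (<⇒below a<b) (sym (<⇒below j<b))
    cases (no _) (yes refl) rewrite transpose-right j l = trans (<⇒below j<b) (sym (<⇒below a<b))
    cases (no lj) (no la) rewrite transpose-other j a l lj la = refl

ξ-comm< : ∀ {n} (a b : Fin n) → toℕ a ℕ.< toℕ b → Commute (ξ a) (ξ b)
ξ-comm< {n} a b a<b = functionally λ g rg → begin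
  Lin g (ξ a *B ξ b)                                                     ≡⟨ Lin-* g (ξ a) (ξ b) ⟩
  Lin (λ y → Lin (λ z → g (mulPP y z)) (ξ b)) (ξ a)                      ≡⟨ Lin-ξ _ a ⟩
  sum (λ j → ind (below j a) Q.* Lin (λ z → g (mulPP (swapPP j a) z)) (ξ b))
    ≡⟨ sum-guarded-cong (λ j → below j a)
         (λ j j<a → ξ-centralises j a b (NP.<-trans (below⇒< j<a) a<b) a<b g rg) ⟩
  sum (λ j → ind (below j a) Q.* Lin (λ z → g (mulPP z (swapPP j a))) (ξ b)) ≡⟨ Lin-ξ _ a ⟨
  Lin (λ y → Lin (λ z → g (mulPP z y)) (ξ b)) (ξ a)                      ≡⟨ Lin-Fubini (λ z y → g (mulPP z y)) (ξ b) (ξ a) ⟨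
  Lin (λ y → Lin (λ z → g (mulPP y z)) (ξ a)) (ξ b)                      ≡⟨ Lin-* g (ξ b) (ξ a) ⟨
  Lin g (ξ b *B ξ a)                                                     ∎
  where open ≡-Reasoning

ξ-comm : ∀ {n} (a b : Fin n) → Commute (ξ a) (ξ b)
ξ-comm a b with NP.<-cmp (toℕ a) (toℕ b)
... | tri< a<b _ _ = ξ-comm< a b a<b
... | tri≈ _ e _ rewrite FinP.toℕ-injective e = ≃-refl
... | tri> _ _ b<a = ≃-sym (ξ-comm< b a b<a)

sum-swap-offdiagonal : ∀ {n} (X Y : Fin n → Fin n → ℚ) →
  (∀ j l → l ≢ j → X l j ≡ Y j l) →
  sum (λ j → sum (λ l → X j l)) Q.+ sum (λ j → Y j j) ≡ sum (λ j → sum (λ l → Y j l)) Q.+ sum (λ j → X j j)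
sum-swap-offdiagonal X Y off = begin
  sum (λ j → sum (λ l → X j l)) Q.+ dY           ≡⟨ cong (Q._+ dY) (trans (∑-comm X) (sum-diagonal (λ j l → X l j))) ⟩
  (offX Q.+ dX) Q.+ dY
    ≡⟨ cong (λ o → (o Q.+ dX) Q.+ dY) (sum-cong-≗ (λ j → sum-cong-≗ (λ l → same j l))) ⟩
  (offY Q.+ dX) Q.+ dY                          ≡⟨ +-rightSwap offY dX dY ⟩
  (offY Q.+ dY) Q.+ dX                          ≡⟨ cong (Q._+ dX) (sym (sum-diagonal Y)) ⟩
  sum (λ j → sum (λ l → Y j l)) Q.+ dX           ∎
  where
  open ≡-Reasoning
  dX = sum (λ j → X j j)
  dY = sum (λ j → Y j j)
  offX = sum (λ j → sum (λ l → if does (l FinP.≟ j) then 0ℚ else X l j))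
  offY = sum (λ j → sum (λ l → if does (l FinP.≟ j) then 0ℚ else Y j l))
  same : ∀ j l → (if does (l FinP.≟ j) then 0ℚ else X l j) ≡ (if does (l FinP.≟ j) then 0ℚ else Y j l)
  same j l with l FinP.≟ j
  ... | yes _ = refl
  ... | no lj = off j l lj

module AdjacentTransposition {n} (I J : Fin n) (J≡I+1 : Adjacent I J) where

  s : Permutation′ n
  s = transpose I J

  I<J : toℕ I ℕ.< toℕ J
  I<J = subst (toℕ I ℕ.<_) (sym J≡I+1) (NP.n<1+n (toℕ I))

  I≢J : I ≢ J
  I≢J = <⇒≢ I<J

  s-below : ∀ j → toℕ j ℕ.< toℕ I → s ⟨$⟩ʳ j ≡ j
  s-below j p = transpose-other I J j (<⇒≢ p) (<⇒≢ (NP.<-trans p I<J))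

  I<k⇒J≤k : ∀ k → k ≢ J → toℕ I ℕ.< toℕ k → toℕ J ℕ.< toℕ k
  I<k⇒J≤k k kJ p = NP.≤∧≢⇒< (subst (ℕ._≤ toℕ k) (sym J≡I+1) p) (λ e → kJ (FinP.toℕ-injective (sym e)))

  below-J : ∀ j → j ≢ I → below j J ≡ below j I
  below-J j jI = below-cong (λ p → below-I p) (λ p → NP.<-trans p I<J)
    where
    below-I : toℕ j ℕ.< toℕ J → toℕ j ℕ.< toℕ I
    below-I p with NP.<-cmp (toℕ j) (toℕ I)
    ... | tri< q _ _ = q
    ... | tri≈ _ e _ = ⊥-elim (jI (FinP.toℕ-injective e))
    ... | tri> _ _ q = ⊥-elim (NP.<-irrefl refl (NP.<-≤-trans p (subst (ℕ._≤ toℕ j) (sym J≡I+1) q)))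

  not-below-self : ∀ (j : Fin n) → below j j ≡ false
  not-below-self j = ≮⇒below {j = j} {k = j} (NP.<-irrefl refl)

  ind-below-J : ∀ j → ind (below j J) ≡ ind (below j I) Q.+ ind (eqᵇ j I)
  ind-below-J j = cases (j FinP.≟ I)
    where
    cases : Dec (j ≡ I) → ind (below j J) ≡ ind (below j I) Q.+ ind (eqᵇ j I)
    cases (yes refl) rewrite <⇒below I<J | not-below-self j | dec-true (j FinP.≟ j) refl = sym (QP.+-identityˡ 1ℚ)
    cases (no jI) rewrite below-J j jI | dec-false (j FinP.≟ I) jI = sym (QP.+-identityʳ _)

  ind-below-sJ : ∀ j → ind (below (s ⟨$⟩ʳ j) J) ≡ ind (below j I) Q.+ ind (eqᵇ j J)
  ind-below-sJ j = cases (j FinP.≟ I) (j FinP.≟ J)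
    where
    cases : Dec (j ≡ I) → Dec (j ≡ J) → ind (below (s ⟨$⟩ʳ j) J) ≡ ind (below j I) Q.+ ind (eqᵇ j J)
    cases (yes refl) _ rewrite transpose-left j J | not-below-self J | not-below-self j | dec-false (j FinP.≟ J) I≢J = refl
    cases (no _) (yes refl) rewrite transpose-right I j | <⇒below I<J
                                  | ≮⇒below {j = j} {k = I} (λ p → NP.<-asym p I<J)
                                  | dec-true (j FinP.≟ j) refl = sym (QP.+-identityˡ 1ℚ)
    cases (no jI) (no jJ) rewrite transpose-other I J j jI jJ | below-J j jI
                                | dec-false (j FinP.≟ J) jJ = sym (QP.+-identityʳ _)

  below-s : ∀ k → k ≢ I → k ≢ J → ∀ j → below (s ⟨$⟩ʳ j) k ≡ below j k
  below-s k kI kJ j = cases (j FinP.≟ I) (j FinP.≟ J)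
    where
    cases : Dec (j ≡ I) → Dec (j ≡ J) → below (s ⟨$⟩ʳ j) k ≡ below j k
    cases (yes refl) _ rewrite transpose-left j J = below-cong (NP.<-trans I<J) (I<k⇒J≤k k kJ)
    cases (no _) (yes refl) rewrite transpose-right I j = below-cong (I<k⇒J≤k k kJ) (NP.<-trans I<J)
    cases (no a) (no b) rewrite transpose-other I J j a b = refl

  act-swapPP : ∀ {a b a' b'} → s ⟨$⟩ʳ a ≡ a' → s ⟨$⟩ʳ b ≡ b' → actPP s (swapPP a b) ≐ swapPP a' b'
  act-swapPP {a} {b} e₁ e₂ = ≐-trans (swapPP-act s a b) (≐-reflexive (cong₂ swapPP e₁ e₂))

  -- s·ξ_k = ξ_k for k ∉ {I, J}: s permutes the summands.
  act-ξ-other : ∀ k → k ≢ I → k ≢ J → act s (ξ k) ≃ ξ k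
  act-ξ-other k kI kJ = functionally λ g rg → begin
    Lin g (act s (ξ k))                                          ≡⟨ trans (Lin-act g s (ξ k)) (Lin-ξ _ k) ⟩
    sum (λ j → ind (below j k) Q.* g (actPP s (swapPP j k)))
      ≡⟨ sum-cong-≗ (λ j → cong₂ (λ x y → ind x Q.* y) (sym (below-s k kI kJ j))
                                 (rg (act-swapPP refl (transpose-other I J k kI kJ)))) ⟩
    sum (λ j → ind (below (s ⟨$⟩ʳ j) k) Q.* g (swapPP (s ⟨$⟩ʳ j) k))
      ≡⟨ sum-permute (λ j → ind (below j k) Q.* g (swapPP j k)) s ⟨
    sum (λ j → ind (below j k) Q.* g (swapPP j k))               ≡⟨ Lin-ξ g k ⟨
    Lin g (ξ k)                                                  ∎
    where open ≡-Reasoning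

  Lin-sξI : ∀ (g : PP n → ℚ) → Respectful g →
    Lin g (act s (ξ I)) ≡ sum (λ j → ind (below j I) Q.* g (swapPP j J))
  Lin-sξI g rg = trans (Lin-act g s (ξ I)) (trans (Lin-ξ _ I)
    (sum-guarded-cong (λ j → below j I) (λ j p → rg (act-swapPP (s-below j (below⇒< p)) (transpose-left I J)))))

  Lin-sξJ : ∀ (g : PP n → ℚ) → Respectful g →
    Lin g (act s (ξ J)) ≡ sum (λ j → ind (below j I) Q.* g (swapPP j I)) Q.+ g (swapPP J I)
  Lin-sξJ g rg = begin
    Lin g (act s (ξ J))                                          ≡⟨ trans (Lin-act g s (ξ J)) (Lin-ξ _ J) ⟩
    sum (λ j → ind (below j J) Q.* g (actPP s (swapPP j J)))
      ≡⟨ sum-cong-≗ (λ j → cong (ind (below j J) Q.*_) (rg (act-swapPP refl (transpose-right I J)))) ⟩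
    sum (λ j → ind (below j J) Q.* g (swapPP (s ⟨$⟩ʳ j) I))      ≡⟨ sum-permute _ s ⟩
    sum (λ j → ind (below (s ⟨$⟩ʳ j) J) Q.* g (swapPP (s ⟨$⟩ʳ (s ⟨$⟩ʳ j)) I))
      ≡⟨ sum-cong-≗ (λ j → cong (λ z → ind (below (s ⟨$⟩ʳ j) J) Q.* g (swapPP z I)) (transpose-involutive I J j)) ⟩
    sum (λ j → ind (below (s ⟨$⟩ʳ j) J) Q.* g (swapPP j I))
      ≡⟨ sum-split-point (λ j → below (s ⟨$⟩ʳ j) J) (λ j → below j I) J (λ j → g (swapPP j I)) ind-below-sJ ⟩
    sum (λ j → ind (below j I) Q.* g (swapPP j I)) Q.+ g (swapPP J I) ∎
    where open ≡-Reasoning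

  Lin-ξJ : ∀ (g : PP n → ℚ) → Lin g (ξ J) ≡ sum (λ j → ind (below j I) Q.* g (swapPP j J)) Q.+ g (swapPP I J)
  Lin-ξJ g = trans (Lin-ξ g J) (sum-split-point (λ j → below j J) (λ j → below j I) I (λ j → g (swapPP j J)) ind-below-J)

  act-ξ-sum : act s (ξ I) +B act s (ξ J) ≃ ξ I +B ξ J
  act-ξ-sum = functionally λ g rg → begin
    Lin g (act s (ξ I) +B act s (ξ J))             ≡⟨ Lin-++ g (act s (ξ I)) (act s (ξ J)) ⟩
    Lin g (act s (ξ I)) Q.+ Lin g (act s (ξ J))    ≡⟨ cong₂ Q._+_ (Lin-sξI g rg) (Lin-sξJ g rg) ⟩
    Σ₁ g Q.+ (Σ₂ g Q.+ g (swapPP J I))             ≡⟨ cong (λ z → Σ₁ g Q.+ (Σ₂ g Q.+ z)) (rg (swapPP-sym J I)) ⟩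
    Σ₁ g Q.+ (Σ₂ g Q.+ g (swapPP I J))             ≡⟨ +-leftSwap (Σ₁ g) (Σ₂ g) (g (swapPP I J)) ⟩
    Σ₂ g Q.+ (Σ₁ g Q.+ g (swapPP I J))             ≡⟨ cong₂ Q._+_ (Lin-ξ g I) (Lin-ξJ g) ⟨
    Lin g (ξ I) Q.+ Lin g (ξ J)                    ≡⟨ Lin-++ g (ξ I) (ξ J) ⟨
    Lin g (ξ I +B ξ J)                             ∎
    where
    open ≡-Reasoning
    Σ₁ Σ₂ : (PP n → ℚ) → ℚ
    Σ₁ g = sum (λ j → ind (below j I) Q.* g (swapPP j J))
    Σ₂ g = sum (λ j → ind (below j I) Q.* g (swapPP j I))

  -- Both sides expand into a double sum over j, l < I
  -- plus a single sum; the double sums agree off the diagonal because disjoint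
  -- transpositions commute, and each diagonal matches the other single sum.
  act-ξ-product : act s (ξ I) *B act s (ξ J) ≃ ξ I *B ξ J
  act-ξ-product = functionally product
    where
    ι : Fin n → ℚ
    ι j = ind (below j I)

    ι-idem : ∀ j x → ι j Q.* (ι j Q.* x) ≡ ι j Q.* x
    ι-idem j x = trans (sym (QP.*-assoc (ι j) (ι j) x)) (cong (Q._* x) (idem (below j I)))
      where idem : ∀ b → ind b Q.* ind b ≡ ind b
            idem true  = QP.*-identityˡ 1ℚ
            idem false = QP.*-zeroˡ 0ℚ

    expand : ∀ (H : Fin n → Fin n → ℚ) (E : Fin n → ℚ) →
      sum (λ j → ι j Q.* (sum (λ l → ι l Q.* H j l) Q.+ E j))
        ≡ sum (λ j → sum (λ l → ι j Q.* (ι l Q.* H j l))) Q.+ sum (λ j → ι j Q.* E j)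
    expand H E =
      trans (sum-cong-≗ (λ j → trans (QP.*-distribˡ-+ (ι j) (sum (λ l → ι l Q.* H j l)) (E j))
                                     (cong (Q._+ ι j Q.* E j) (*-distribˡ-sum (ι j) (λ l → ι l Q.* H j l)))))
            (∑-distrib-+ (λ j → sum (λ l → ι j Q.* (ι l Q.* H j l))) (λ j → ι j Q.* E j))

    product : ∀ (g : PP n → ℚ) → Respectful g → Lin g (act s (ξ I) *B act s (ξ J)) ≡ Lin g (ξ I *B ξ J)
    product g rg = begin
      Lin g (act s (ξ I) *B act s (ξ J))                     ≡⟨ Lin-* g (act s (ξ I)) (act s (ξ J)) ⟩
      Lin (λ y → Lin (λ z → g (mulPP y z)) (act s (ξ J))) (act s (ξ I))
        ≡⟨ Lin-sξI _ (λ e → Lin-cong (act s (ξ J)) (λ z → rg (mulPP-resp e (≐-refl z)))) ⟩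
      sum (λ j → ι j Q.* Lin (λ z → g (mulPP (swapPP j J) z)) (act s (ξ J)))
        ≡⟨ sum-cong-≗ (λ j → cong (ι j Q.*_) (Lin-sξJ _ (λ e → rg (mulPP-resp (≐-refl (swapPP j J)) e)))) ⟩
      sum (λ j → ι j Q.* (sum (λ l → ι l Q.* F j l) Q.+ Ds j)) ≡⟨ expand F Ds ⟩
      sum (λ j → sum (λ l → X j l)) Q.+ sum (λ j → ι j Q.* Ds j)
        ≡⟨ cong (sum (λ j → sum (λ l → X j l)) Q.+_) (sum-cong-≗ (λ j → sym (diagonalY j))) ⟩
      sum (λ j → sum (λ l → X j l)) Q.+ sum (λ j → Y j j)    ≡⟨ sum-swap-offdiagonal X Y offdiagonal ⟩
      sum (λ j → sum (λ l → Y j l)) Q.+ sum (λ j → X j j)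
        ≡⟨ cong (sum (λ j → sum (λ l → Y j l)) Q.+_) (sum-cong-≗ diagonalX) ⟩
      sum (λ j → sum (λ l → Y j l)) Q.+ sum (λ j → ι j Q.* Dt j) ≡⟨ expand G Dt ⟨
      sum (λ j → ι j Q.* (sum (λ l → ι l Q.* G j l) Q.+ Dt j))
        ≡⟨ sum-cong-≗ (λ j → cong (ι j Q.*_) (Lin-ξJ (λ z → g (mulPP (swapPP j I) z)))) ⟨
      sum (λ j → ι j Q.* Lin (λ z → g (mulPP (swapPP j I) z)) (ξ J)) ≡⟨ Lin-ξ _ I ⟨
      Lin (λ y → Lin (λ z → g (mulPP y z)) (ξ J)) (ξ I)      ≡⟨ Lin-* g (ξ I) (ξ J) ⟨
      Lin g (ξ I *B ξ J)                                     ∎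
      where
      open ≡-Reasoning
      F G X Y : Fin n → Fin n → ℚ
      F j l = g (mulPP (swapPP j J) (swapPP l I))
      G j l = g (mulPP (swapPP j I) (swapPP l J))
      X j l = ι j Q.* (ι l Q.* F j l)
      Y j l = ι j Q.* (ι l Q.* G j l)
      Ds Dt : Fin n → ℚ
      Ds j = g (mulPP (swapPP j J) (swapPP J I))
      Dt j = g (mulPP (swapPP j I) (swapPP I J))

      offdiagonal : ∀ j l → l ≢ j → X l j ≡ Y j l
      offdiagonal j l l≢j = trans (*-leftSwap (ι l) (ι j) (F l j))
        (guarded-cong (below j I) λ j<I → guarded-cong (below l I) λ l<I →
          rg (swapPP-exchange′ l J j I j I
               (transpose-other l J j (λ e → l≢j (sym e)) (λ e → <⇒≢ (NP.<-trans (below⇒< j<I) I<J) e))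
               (transpose-other l J I (λ e → <⇒≢ (below⇒< l<I) (sym e)) I≢J)))

      diagonalX : ∀ j → X j j ≡ ι j Q.* Dt j
      diagonalX j = trans (ι-idem j (F j j)) (guarded-cong (below j I) λ j<I → rg (≐-sym
        (swapPP-exchange′ j I I J j J (transpose-right j I)
          (transpose-other j I J (λ e → <⇒≢ (NP.<-trans (below⇒< j<I) I<J) (sym e)) (λ e → I≢J (sym e))))))

      diagonalY : ∀ j → Y j j ≡ ι j Q.* Ds j
      diagonalY j = trans (ι-idem j (G j j)) (guarded-cong (below j I) λ j<I → rg (≐-sym
        (swapPP-exchange′ j J J I j I (transpose-right j J)
          (transpose-other j J I (λ e → <⇒≢ (below⇒< j<I) (sym e)) I≢J))))

-- Evaluation of symmetric functions at a family of m elements of B_n.  For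
-- m = n, evalSym′ f x unfolds to the evaluation evalSym f x of Defs, so fξ f n
-- is definitionally evalSym′ f ξ.

Π : ∀ {m n} → List (Fin m) → (Fin m → B n) → B n
Π L F = foldr (λ i r → F i *B r) 1B L

monomial : ∀ {m n} → (Fin m → B n) → Vec ℕ m → B n
monomial {m} x α = Π (allFin m) (λ i → x i ^B lookup α i)

sumB : ∀ {X : Set} {n} → List X → (X → B n) → B n
sumB E F = foldr (λ α r → F α +B r) 0B E

evalMonomialSym : ∀ {m n} → (Fin m → B n) → Partition → B n
evalMonomialSym {m} x λp = sumB (exponents m λp) (monomial x)

evalSym′ : ∀ {m n} → SymFun → (Fin m → B n) → B n
evalSym′ f x = sumB f (λ cλ → proj₁ cλ ·B evalMonomialSym x (proj₂ cλ))

Π-++ : ∀ {m n} (L₁ L₂ : List (Fin m)) (F : Fin m → B n) → Π (L₁ ++ L₂) F ≃ Π L₁ F *B Π L₂ F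
Π-++ []       L₂ F = ≃-sym (*-identityˡ (Π L₂ F))
Π-++ (k ∷ L₁) L₂ F = ≃-trans (*-congˡ (F k) (Π-++ L₁ L₂ F)) (≃-sym (*-assoc (F k) (Π L₁ F) (Π L₂ F)))

Π-cong : ∀ {m n} (L : List (Fin m)) {F G : Fin m → B n} → All (λ k → F k ≃ G k) L → Π L F ≃ Π L G
Π-cong []      []       = ≃-refl
Π-cong (k ∷ L) (p ∷ ps) = *-cong p (Π-cong L ps)

sumB-cong : ∀ {X : Set} {n} (E : List X) {F G : X → B n} → (∀ α → F α ≃ G α) → sumB E F ≃ sumB E G
sumB-cong []      p = ≃-refl
sumB-cong (α ∷ E) p = +-cong (p α) (sumB-cong E p)

evalSym′-cong : ∀ {m n} (f : SymFun) {x x' : Fin m → B n} → (∀ k → x k ≃ x' k) → evalSym′ f x ≃ evalSym′ f x'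
evalSym′-cong {m} f p = sumB-cong f λ (c , λp) → ·-cong c (sumB-cong (exponents m λp) λ α →
  Π-cong (allFin m) (All.universal (λ i → ^-cong (lookup α i) (p i)) (allFin m)))

record ProductClosed {n} (Good : B n → Set) : Set where
  field
    good-1 : Good 1B
    good-* : ∀ {a b} → Good a → Good b → Good (a *B b)

module _ {n} {Good : B n → Set} (closed : ProductClosed Good) where
  open ProductClosed closed

  good-^ : ∀ {a} k → Good a → Good (a ^B k)
  good-^ zero    g = good-1
  good-^ (suc k) g = good-* g (good-^ k g)

  good-Π : ∀ {m} (L : List (Fin m)) (F : Fin m → B n) → (∀ k → Good (F k)) → Good (Π L F)
  good-Π []      F g = good-1
  good-Π (k ∷ L) F g = good-* (g k) (good-Π L F g)

  good-monomial : ∀ {m} (x : Fin m → B n) → (∀ k → Good (x k)) → ∀ α → Good (monomial x α)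
  good-monomial {m} x g α = good-Π (allFin m) (λ i → x i ^B lookup α i) (λ i → good-^ (lookup α i) (g i))

-- A map B_n → B_n' which is additive, ℚ-linear and unital, and multiplicative
-- on a product-closed class of "good" elements, commutes with the evaluation
-- of every symmetric function at good elements.  Both the S_n-action and the
-- projection π are such maps.
record AlgebraMap {n n'} (φ : B n → B n') (Good : B n → Set) : Set where
  field
    φ-0    : φ 0B ≃ 0B
    φ-+    : ∀ a b → φ (a +B b) ≃ φ a +B φ b
    φ-·    : ∀ c a → φ (c ·B a) ≃ c ·B φ a
    φ-1    : φ 1B ≃ 1B
    φ-*    : ∀ {a b} → Good a → Good b → φ (a *B b) ≃ φ a *B φ b
    closed : ProductClosed Good

module _ {n n'} {φ : B n → B n'} {Good : B n → Set} (h : AlgebraMap φ Good) where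
  open AlgebraMap h

  φ-^ : ∀ {a} k → Good a → φ (a ^B k) ≃ φ a ^B k
  φ-^ zero    g = φ-1
  φ-^ {a} (suc k) g = ≃-trans (φ-* g (good-^ closed k g)) (*-congˡ (φ a) (φ-^ k g))

  φ-Π : ∀ {m} (L : List (Fin m)) (F : Fin m → B n) → (∀ k → Good (F k)) → φ (Π L F) ≃ Π L (λ k → φ (F k))
  φ-Π []      F g = φ-1
  φ-Π (k ∷ L) F g = ≃-trans (φ-* (g k) (good-Π closed L F g)) (*-congˡ (φ (F k)) (φ-Π L F g))

  φ-sumB : ∀ {X : Set} (E : List X) (F : X → B n) (G : X → B n') → (∀ α → φ (F α) ≃ G α) → φ (sumB E F) ≃ sumB E G
  φ-sumB []      F G p = φ-0
  φ-sumB (α ∷ E) F G p = ≃-trans (φ-+ (F α) (sumB E F)) (+-cong (p α) (φ-sumB E F G p))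

  φ-monomial : ∀ {m} (x : Fin m → B n) → (∀ k → Good (x k)) → ∀ α → φ (monomial x α) ≃ monomial (λ k → φ (x k)) α
  φ-monomial {m} x g α =
    ≃-trans (φ-Π (allFin m) (λ i → x i ^B lookup α i) (λ i → good-^ closed (lookup α i) (g i)))
            (Π-cong (allFin m) (All.universal (λ i → φ-^ (lookup α i) (g i)) (allFin m)))

  φ-evalSym′ : ∀ {m} (f : SymFun) (x : Fin m → B n) → (∀ k → Good (x k)) →
    φ (evalSym′ f x) ≃ evalSym′ f (λ k → φ (x k))
  φ-evalSym′ {m} f x g = φ-sumB f _ _ λ (c , λp) →
    ≃-trans (φ-· c (evalMonomialSym x λp)) (·-cong c (φ-sumB (exponents m λp) (monomial x) _ (φ-monomial x g)))

listSum : ∀ {X : Set} → List X → (X → ℚ) → ℚ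
listSum []      φ = 0ℚ
listSum (x ∷ L) φ = φ x Q.+ listSum L φ

listSum-++ : ∀ {X : Set} (L M : List X) (φ : X → ℚ) → listSum (L ++ M) φ ≡ listSum L φ Q.+ listSum M φ
listSum-++ []      M φ = sym (QP.+-identityˡ (listSum M φ))
listSum-++ (x ∷ L) M φ = trans (cong (φ x Q.+_) (listSum-++ L M φ)) (sym (QP.+-assoc (φ x) (listSum L φ) (listSum M φ)))

listSum-map : ∀ {X Y : Set} (f : X → Y) (L : List X) (φ : Y → ℚ) → listSum (map f L) φ ≡ listSum L (λ x → φ (f x))
listSum-map f []      φ = refl
listSum-map f (x ∷ L) φ = cong (φ (f x) Q.+_) (listSum-map f L φ)

listSum-concatMap : ∀ {X Y : Set} (h : X → List Y) (L : List X) (φ : Y → ℚ) →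
  listSum (concatMap h L) φ ≡ listSum L (λ x → listSum (h x) φ)
listSum-concatMap h []      φ = refl
listSum-concatMap h (x ∷ L) φ =
  trans (listSum-++ (h x) (concatMap h L) φ) (cong (listSum (h x) φ Q.+_) (listSum-concatMap h L φ))

listSum-cong : ∀ {X : Set} (L : List X) {φ ψ : X → ℚ} → (∀ x → φ x ≡ ψ x) → listSum L φ ≡ listSum L ψ
listSum-cong []      p = refl
listSum-cong (x ∷ L) p = cong₂ Q._+_ (p x) (listSum-cong L p)

listSum-+ : ∀ {X : Set} (L : List X) (φ ψ : X → ℚ) → listSum L (λ x → φ x Q.+ ψ x) ≡ listSum L φ Q.+ listSum L ψ
listSum-+ []      φ ψ = sym (QP.+-identityˡ 0ℚ)
listSum-+ (x ∷ L) φ ψ = trans (cong ((φ x Q.+ ψ x) Q.+_) (listSum-+ L φ ψ)) (+-interchange (φ x) (ψ x) (listSum L φ) (listSum L ψ))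

listSum-0 : ∀ {X : Set} (L : List X) → listSum L (λ _ → 0ℚ) ≡ 0ℚ
listSum-0 []      = refl
listSum-0 (x ∷ L) = cong (0ℚ Q.+_) (listSum-0 L)

listSum-comm : ∀ {X Y : Set} (K : List X) (M : List Y) (h : X → Y → ℚ) →
  listSum K (λ a → listSum M (h a)) ≡ listSum M (λ b → listSum K (λ a → h a b))
listSum-comm []      M h = sym (listSum-0 M)
listSum-comm (a ∷ K) M h =
  trans (cong (listSum M (h a) Q.+_) (listSum-comm K M h)) (sym (listSum-+ M (h a) (λ b → listSum K (λ a → h a b))))

listSum-filter : ∀ {X : Set} (P : X → Bool) (L : List X) (φ : X → ℚ) →
  listSum (filterᵇ P L) φ ≡ listSum L (λ x → ind (P x) Q.* φ x)
listSum-filter P []      φ = refl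
listSum-filter P (x ∷ L) φ with P x
... | true  = cong₂ Q._+_ (sym (QP.*-identityˡ (φ x))) (listSum-filter P L φ)
... | false = trans (listSum-filter P L φ)
                (sym (trans (cong (Q._+ listSum L (λ x → ind (P x) Q.* φ x)) (QP.*-zeroˡ (φ x))) (QP.+-identityˡ _)))

Lin-sumB : ∀ {n} {X : Set} (g : PP n → ℚ) (E : List X) (F : X → B n) →
  Lin g (sumB E F) ≡ listSum E (λ α → Lin g (F α))
Lin-sumB g []      F = refl
Lin-sumB g (α ∷ E) F = trans (Lin-++ g (F α) (sumB E F)) (cong (Lin g (F α) Q.+_) (Lin-sumB g E F))

listSum-vecsUpTo : ∀ N m (φ : Vec ℕ (suc m) → ℚ) →
  listSum (vecsUpTo N (suc m)) φ ≡ listSum (upTo (suc N)) (λ a → listSum (vecsUpTo N m) (λ w → φ (a Vec.∷ w)))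
listSum-vecsUpTo N m φ =
  trans (listSum-concatMap (λ k → map (k Vec.∷_) (vecsUpTo N m)) (upTo (suc N)) φ)
        (listSum-cong (upTo (suc N)) (λ a → listSum-map (a Vec.∷_) (vecsUpTo N m) φ))

Avoid : ∀ {n} → Fin n → Fin n → Fin n → Set
Avoid I J k = (k ≢ I) × (k ≢ J)

split : ∀ {n} (I J : Fin n) → Adjacent I J →
  Σ (List (Fin n)) λ pre → Σ (List (Fin n)) λ post →
  (allFin n ≡ pre ++ I ∷ J ∷ post) × All (Avoid I J) pre × All (Avoid I J) post
split Fin.zero (Fin.suc Fin.zero) refl =
  [] , List.tabulate (λ k → Fin.suc (Fin.suc k)) , refl , [] , AllP.tabulate⁺ (λ k → (λ ()) , (λ ()))
split (Fin.suc I) (Fin.suc J) e with split I J (NP.suc-injective e)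
... | pre , post , eq , ap , aq =
  Fin.zero ∷ map Fin.suc pre , map Fin.suc post , eq' ,
  ((λ ()) , (λ ())) ∷ AllP.map⁺ (All.map lift ap) , AllP.map⁺ (All.map lift aq)
  where
  lift : ∀ {k} → Avoid I J k → Avoid (Fin.suc I) (Fin.suc J) (Fin.suc k)
  lift (a , b) = (λ x → a (FinP.suc-injective x)) , (λ x → b (FinP.suc-injective x))
  eq' : allFin (suc _) ≡ (Fin.zero ∷ map Fin.suc pre) ++ Fin.suc I ∷ Fin.suc J ∷ map Fin.suc post
  eq' = cong (Fin.zero ∷_) (trans (sym (ListP.map-tabulate (λ k → k) Fin.suc))
          (trans (cong (map Fin.suc) eq) (ListP.map-++ Fin.suc pre (I ∷ J ∷ post))))

swapAt : ∀ {A : Set} {n} (I J : Fin n) → Adjacent I J → Vec A n → Vec A n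
swapAt Fin.zero    (Fin.suc Fin.zero) refl (a Vec.∷ b Vec.∷ v) = b Vec.∷ a Vec.∷ v
swapAt (Fin.suc I) (Fin.suc J)        e    (a Vec.∷ v)         = a Vec.∷ swapAt I J (NP.suc-injective e) v

swapAt-I : ∀ {A : Set} {n} (I J : Fin n) (e : Adjacent I J) (v : Vec A n) → lookup (swapAt I J e v) I ≡ lookup v J
swapAt-I Fin.zero    (Fin.suc Fin.zero) refl (a Vec.∷ b Vec.∷ v) = refl
swapAt-I (Fin.suc I) (Fin.suc J)        e    (a Vec.∷ v)         = swapAt-I I J (NP.suc-injective e) v

swapAt-J : ∀ {A : Set} {n} (I J : Fin n) (e : Adjacent I J) (v : Vec A n) → lookup (swapAt I J e v) J ≡ lookup v I
swapAt-J Fin.zero    (Fin.suc Fin.zero) refl (a Vec.∷ b Vec.∷ v) = refl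
swapAt-J (Fin.suc I) (Fin.suc J)        e    (a Vec.∷ v)         = swapAt-J I J (NP.suc-injective e) v

swapAt-other : ∀ {A : Set} {n} (I J : Fin n) (e : Adjacent I J) (v : Vec A n) k → Avoid I J k →
  lookup (swapAt I J e v) k ≡ lookup v k
swapAt-other Fin.zero (Fin.suc Fin.zero) refl (a Vec.∷ b Vec.∷ v) Fin.zero                 (p , q) = ⊥-elim (p refl)
swapAt-other Fin.zero (Fin.suc Fin.zero) refl (a Vec.∷ b Vec.∷ v) (Fin.suc Fin.zero)       (p , q) = ⊥-elim (q refl)
swapAt-other Fin.zero (Fin.suc Fin.zero) refl (a Vec.∷ b Vec.∷ v) (Fin.suc (Fin.suc k)) _       = refl
swapAt-other (Fin.suc I) (Fin.suc J) e (a Vec.∷ v) Fin.zero    _       = refl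
swapAt-other (Fin.suc I) (Fin.suc J) e (a Vec.∷ v) (Fin.suc k) (p , q) =
  swapAt-other I J (NP.suc-injective e) v k ((λ x → p (cong Fin.suc x)) , (λ x → q (cong Fin.suc x)))

occ-∷ : ∀ k a xs → occ k (a ∷ xs) ≡ (if a ℕ.≡ᵇ k then suc (occ k xs) else occ k xs)
occ-∷ k a xs with a ℕ.≡ᵇ k
... | true  = refl
... | false = refl

occ-swap₂ : ∀ k a b xs → occ k (a ∷ b ∷ xs) ≡ occ k (b ∷ a ∷ xs)
occ-swap₂ k a b xs rewrite occ-∷ k a (b ∷ xs) | occ-∷ k b (a ∷ xs) | occ-∷ k a xs | occ-∷ k b xs
  with a ℕ.≡ᵇ k | b ℕ.≡ᵇ k
... | true  | true  = refl
... | true  | false = refl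
... | false | true  = refl
... | false | false = refl

occ-∷-cong : ∀ k a {xs ys} → occ k xs ≡ occ k ys → occ k (a ∷ xs) ≡ occ k (a ∷ ys)
occ-∷-cong k a {xs} {ys} e rewrite occ-∷ k a xs | occ-∷ k a ys | e = refl

occ-swapAt : ∀ {n} (I J : Fin n) (e : Adjacent I J) (v : Vec ℕ n) k →
  occ k (Vec.toList (swapAt I J e v)) ≡ occ k (Vec.toList v)
occ-swapAt Fin.zero    (Fin.suc Fin.zero) refl (a Vec.∷ b Vec.∷ v) k = occ-swap₂ k b a (Vec.toList v)
occ-swapAt (Fin.suc I) (Fin.suc J)        e    (a Vec.∷ v)         k = occ-∷-cong k a (occ-swapAt I J (NP.suc-injective e) v k)

isRearr-swapAt : ∀ {n} (I J : Fin n) (e : Adjacent I J) (λs : List ℕ) (v : Vec ℕ n) →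
  isRearr λs (swapAt I J e v) ≡ isRearr λs v
isRearr-swapAt I J e λs v =
  cong and (ListP.map-cong (λ k → cong (ℕ._≡ᵇ occ k λs) (occ-swapAt I J e v k)) (applyUpTo suc (sumℕ λs)))

listSum-swapAt : ∀ N {n} (I J : Fin n) (e : Adjacent I J) (φ : Vec ℕ n → ℚ) →
  listSum (vecsUpTo N n) φ ≡ listSum (vecsUpTo N n) (λ α → φ (swapAt I J e α))
listSum-swapAt N {suc (suc m)} Fin.zero (Fin.suc Fin.zero) refl φ = begin
  listSum (vecsUpTo N (suc (suc m))) φ                               ≡⟨ listSum-vecsUpTo N (suc m) φ ⟩
  listSum K (λ a → listSum (vecsUpTo N (suc m)) (λ w → φ (a Vec.∷ w))) ≡⟨ listSum-cong K (λ a → listSum-vecsUpTo N m _) ⟩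
  listSum K (λ a → listSum K (λ b → listSum V (λ v → φ (a Vec.∷ b Vec.∷ v))))
    ≡⟨ listSum-comm K K (λ a b → listSum V (λ v → φ (a Vec.∷ b Vec.∷ v))) ⟩
  listSum K (λ b → listSum K (λ a → listSum V (λ v → φ (a Vec.∷ b Vec.∷ v))))
    ≡⟨ listSum-cong K (λ b → listSum-vecsUpTo N m (λ w → φ (swapAt Fin.zero (Fin.suc Fin.zero) refl (b Vec.∷ w)))) ⟨
  listSum K (λ b → listSum (vecsUpTo N (suc m)) (λ w → φ (swapAt Fin.zero (Fin.suc Fin.zero) refl (b Vec.∷ w))))
    ≡⟨ listSum-vecsUpTo N (suc m) (λ α → φ (swapAt Fin.zero (Fin.suc Fin.zero) refl α)) ⟨
  listSum (vecsUpTo N (suc (suc m))) (λ α → φ (swapAt Fin.zero (Fin.suc Fin.zero) refl α)) ∎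
  where
  open ≡-Reasoning
  K = upTo (suc N)
  V = vecsUpTo N m
listSum-swapAt N {suc m} (Fin.suc I) (Fin.suc J) e φ =
  trans (listSum-vecsUpTo N m φ)
    (trans (listSum-cong (upTo (suc N)) (λ a → listSum-swapAt N I J (NP.suc-injective e) (λ w → φ (a Vec.∷ w))))
           (sym (listSum-vecsUpTo N m (λ α → φ (swapAt (Fin.suc I) (Fin.suc J) e α)))))

-- ℚ has characteristic zero.
halve : ∀ {a b : ℚ} → a Q.+ a ≡ b Q.+ b → a ≡ b
halve {a} {b} e = trans (half-double a) (trans (cong (Q.½ Q.*_) e) (sym (half-double b)))
  where
  open +-*-Solver using (solve; _:=_; _:+_; _:*_; con)
  half-double : ∀ u → u ≡ Q.½ Q.* (u Q.+ u)
  half-double = solve 1 (λ u → u := con Q.½ :* (u :+ u)) refl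

-- Summands of m_λ are paired with their
-- images under the exchange of exponents at I and J; each pair contains the
-- factor u^p v^q + u^q v^p, which only depends on u + v and uv.
module SwapInvariance {m n} (I J : Fin m) (adj : Adjacent I J) (x y : Fin m → B n)
  (cx : Commute (x I) (x J)) (cy : Commute (y I) (y J))
  (others : ∀ k → Avoid I J k → y k ≃ x k)
  (sum≃ : y I +B y J ≃ x I +B x J) (prod≃ : y I *B y J ≃ x I *B x J) where

  open SymMonomialDetermined (y I) (y J) (x I) (x J) cy cx sum≃ prod≃

  sw : Vec ℕ m → Vec ℕ m
  sw = swapAt I J adj

  powers : (Fin m → B n) → Vec ℕ m → Fin m → B n
  powers z β k = z k ^B lookup β k

  pre post : List (Fin m)
  pre  = proj₁ (split I J adj)
  post = proj₁ (proj₂ (split I J adj))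

  outside : ∀ (z : Fin m → B n) β' β → (∀ k → Avoid I J k → powers z β' k ≃ powers x β k) →
    ∀ L → All (Avoid I J) L → Π L (powers z β') ≃ Π L (powers x β)
  outside z β' β h L av = Π-cong L (All.map (λ {k} → h k) av)

  factor : ∀ (z : Fin m → B n) β' β → (∀ k → Avoid I J k → powers z β' k ≃ powers x β k) →
    monomial z β' ≃ Π pre (powers x β) *B ((z I ^B lookup β' I) *B ((z J ^B lookup β' J) *B Π post (powers x β)))
  factor z β' β h =
    ≃-trans (≃-reflexive (cong (λ L → Π L (powers z β')) (proj₁ (proj₂ (proj₂ (split I J adj))))))
      (≃-trans (Π-++ pre (I ∷ J ∷ post) (powers z β'))
        (*-cong (outside z β' β h pre apre) (*-congˡ (z I ^B lookup β' I) (*-congˡ (z J ^B lookup β' J)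
                (outside z β' β h post apost)))))
    where
    apre  = proj₁ (proj₂ (proj₂ (proj₂ (split I J adj))))
    apost = proj₂ (proj₂ (proj₂ (proj₂ (split I J adj))))

  factor-sw : ∀ (z : Fin m → B n) β → (∀ k → Avoid I J k → z k ≃ x k) →
    monomial z (sw β) ≃ Π pre (powers x β) *B ((z I ^B lookup β J) *B ((z J ^B lookup β I) *B Π post (powers x β)))
  factor-sw z β h = ≃-trans (factor z (sw β) β (λ k a → subst (λ e → z k ^B e ≃ powers x β k)
                                                             (sym (swapAt-other I J adj β k a)) (^-cong (lookup β k) (h k a))))
                      (≃-reflexive (cong₂ (λ p q → Π pre (powers x β) *B ((z I ^B p) *B ((z J ^B q) *B Π post (powers x β))))
                                          (swapAt-I I J adj β) (swapAt-J I J adj β)))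

  sandwich : ∀ (A C u v : B n) p q →
    (A *B ((u ^B p) *B ((v ^B q) *B C))) +B (A *B ((u ^B q) *B ((v ^B p) *B C))) ≃ A *B (symMonomial u v p q *B C)
  sandwich A C u v p q = begin
    (A *B ((u ^B p) *B ((v ^B q) *B C))) +B (A *B ((u ^B q) *B ((v ^B p) *B C)))
      ≈⟨ *-distribˡ A _ _ ⟨
    A *B (((u ^B p) *B ((v ^B q) *B C)) +B ((u ^B q) *B ((v ^B p) *B C)))
      ≈⟨ *-congˡ A (+-cong (*-assoc (u ^B p) (v ^B q) C) (*-assoc (u ^B q) (v ^B p) C)) ⟨
    A *B ((((u ^B p) *B (v ^B q)) *B C) +B (((u ^B q) *B (v ^B p)) *B C))
      ≈⟨ *-congˡ A (*-distribʳ ((u ^B p) *B (v ^B q)) ((u ^B q) *B (v ^B p)) C) ⟨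
    A *B (symMonomial u v p q *B C) ∎
    where open ≃-Reasoning

  pair : ∀ β → monomial y β +B monomial y (sw β) ≃ monomial x β +B monomial x (sw β)
  pair β = begin
    monomial y β +B monomial y (sw β)
      ≈⟨ +-cong (factor y β β (λ k a → ^-cong (lookup β k) (others k a))) (factor-sw y β others) ⟩
    (A *B ((y I ^B p) *B ((y J ^B q) *B C))) +B (A *B ((y I ^B q) *B ((y J ^B p) *B C)))
      ≈⟨ sandwich A C (y I) (y J) p q ⟩
    A *B (symMonomial (y I) (y J) p q *B C)
      ≈⟨ *-congˡ A (*-congʳ C (symMonomial≃ p q)) ⟩
    A *B (symMonomial (x I) (x J) p q *B C)
      ≈⟨ sandwich A C (x I) (x J) p q ⟨
    (A *B ((x I ^B p) *B ((x J ^B q) *B C))) +B (A *B ((x I ^B q) *B ((x J ^B p) *B C)))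
      ≈⟨ +-cong (factor x β β (λ k a → ≃-refl)) (factor-sw x β (λ k a → ≃-refl)) ⟨
    monomial x β +B monomial x (sw β) ∎
    where
    open ≃-Reasoning
    p = lookup β I
    q = lookup β J
    A = Π pre (powers x β)
    C = Π post (powers x β)

  module _ (λp : Partition) where
    V : List (Vec ℕ m)
    V = vecsUpTo (sumℕ (parts λp)) m

    ι : Vec ℕ m → ℚ
    ι α = ind (isRearr (parts λp) α)

    twice : ∀ (z : Fin m → B n) (g : PP n → ℚ) →
      Lin g (evalMonomialSym z λp) Q.+ Lin g (evalMonomialSym z λp)
        ≡ listSum V (λ α → ι α Q.* Lin g (monomial z α +B monomial z (sw α)))
    twice z g = begin
      Lin g (evalMonomialSym z λp) Q.+ Lin g (evalMonomialSym z λp)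
        ≡⟨ cong (λ t → t Q.+ t) once ⟩
      listSum V (λ α → ι α Q.* Φ α) Q.+ listSum V (λ α → ι α Q.* Φ α)
        ≡⟨ cong (listSum V (λ α → ι α Q.* Φ α) Q.+_) swapped ⟩
      listSum V (λ α → ι α Q.* Φ α) Q.+ listSum V (λ α → ι α Q.* Φ (sw α))
        ≡⟨ listSum-+ V (λ α → ι α Q.* Φ α) (λ α → ι α Q.* Φ (sw α)) ⟨
      listSum V (λ α → ι α Q.* Φ α Q.+ ι α Q.* Φ (sw α))
        ≡⟨ listSum-cong V (λ α → trans (sym (QP.*-distribˡ-+ (ι α) (Φ α) (Φ (sw α))))
                                       (cong (ι α Q.*_) (sym (Lin-++ g (monomial z α) (monomial z (sw α)))))) ⟩
      listSum V (λ α → ι α Q.* Lin g (monomial z α +B monomial z (sw α))) ∎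
      where
      open ≡-Reasoning
      Φ : Vec ℕ m → ℚ
      Φ α = Lin g (monomial z α)
      once : Lin g (evalMonomialSym z λp) ≡ listSum V (λ α → ι α Q.* Φ α)
      once = trans (Lin-sumB g (exponents m λp) (monomial z)) (listSum-filter (isRearr (parts λp)) V Φ)
      swapped : listSum V (λ α → ι α Q.* Φ α) ≡ listSum V (λ α → ι α Q.* Φ (sw α))
      swapped = trans (listSum-swapAt (sumℕ (parts λp)) I J adj (λ α → ι α Q.* Φ α))
                      (listSum-cong V (λ α → cong (λ b → ind b Q.* Φ (sw α)) (isRearr-swapAt I J adj (parts λp) α)))

    evalMonomialSym-invariant : evalMonomialSym y λp ≃ evalMonomialSym x λp
    evalMonomialSym-invariant = functionally λ g rg →
      halve (trans (twice y g) (trans (listSum-cong V (λ α → cong (ι α Q.*_) (agree (pair α) g rg)))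
                                      (sym (twice x g))))

  evalSym′-invariant : ∀ (f : SymFun) → evalSym′ f y ≃ evalSym′ f x
  evalSym′-invariant f = sumB-cong f λ (c , λp) → ·-cong c (evalMonomialSym-invariant λp)

act-algebraMap : ∀ {n} (τ : Permutation′ n) → AlgebraMap (act τ) (λ _ → ⊤)
act-algebraMap τ = record
  { φ-0 = ≃-refl ; φ-+ = act-+ τ ; φ-· = act-· τ ; φ-1 = act-1 τ
  ; φ-* = λ {a} {b} _ _ → act-* τ a b
  ; closed = record { good-1 = tt ; good-* = λ _ _ → tt } }

-- f(ξ) is fixed by every adjacent transposition s: s·f(ξ) = f(s·ξ), and the
-- family s·ξ differs from ξ only by an exchange preserving sum and product.
adjacent-invariant : ∀ {n} (f : SymFun) (I J : Fin n) → Adjacent I J → act (transpose I J) (fξ f n) ≃ fξ f n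
adjacent-invariant {n} f I J adj =
  ≃-trans (φ-evalSym′ (act-algebraMap s) f ξ (λ _ → tt))
    (SwapInvariance.evalSym′-invariant I J adj ξ (λ k → act s (ξ k)) (ξ-comm I J) sξ-comm
       (λ k (kI , kJ) → act-ξ-other k kI kJ) act-ξ-sum act-ξ-product f)
  where
  open AdjacentTransposition I J adj
  sξ-comm : Commute (act s (ξ I)) (act s (ξ J))
  sξ-comm = ≃-trans (≃-sym (act-* s (ξ I) (ξ J))) (≃-trans (act-cong s (ξ-comm I J)) (act-* s (ξ J) (ξ I)))

invariant : ∀ {n} (f : SymFun) (τ : Permutation′ n) → act τ (fξ f n) ≈ fξ f n
invariant {n} f τ = ≃⇒≈ (fixed-by-adjacent⇒fixed (fξ f n) (adjacent-invariant f) τ)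

∉⇒false : ∀ {n} {d : Subset n} {i} → i ∉ d → lookup d i ≡ false
∉⇒false {d = d} {i} i∉d with lookup d i in e
... | true  = ⊥-elim (i∉d (VecP.lookup⇒[]= i d e))
... | false = refl

false⇒∉ : ∀ {n} {d : Subset n} {i} → lookup d i ≡ false → i ∉ d
false⇒∉ e i∈d with () ← trans (sym e) (VecP.[]=⇒lookup i∈d)

∨-false : ∀ {a b : Bool} → (a ∨ b) ≡ false → (a ≡ false) × (b ≡ false)
∨-false {false} {false} _ = refl , refl

Valid-mulPP : ∀ {n} (y z : PP n) → Valid y → Valid z → Valid (mulPP y z)
Valid-mulPP (σ , d) (τ , e) vy vz i i∉ with ∨-false (trans (sym (lookup-∪ d e i)) (∉⇒false i∉))
... | i∉d , i∉e = trans (cong (σ ⟨$⟩ʳ_) (vz i (false⇒∉ i∉e))) (vy i (false⇒∉ i∉d))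

InB-++ : ∀ {n} {a b : B n} → InB a → InB b → InB (a +B b)
InB-++ = AllP.++⁺

InB-· : ∀ {n} (c : ℚ) {a : B n} → InB a → InB (c ·B a)
InB-· c v = AllP.map⁺ v

InB-closed : ∀ {n} → ProductClosed (InB {n})
InB-closed = record { good-1 = (λ i _ → refl) ∷ [] ; good-* = InB-* }
  where
  InB-* : ∀ {n} {a b : B n} → InB a → InB b → InB (a *B b)
  InB-* []         vb = []
  InB-* {a = (c , y) ∷ a} (va ∷ vas) vb =
    AllP.++⁺ (AllP.map⁺ (All.map (λ {dz} vz → Valid-mulPP y (proj₂ dz) va vz) vb)) (InB-* vas vb)

Valid-swapPP : ∀ {n} (j k : Fin n) → Valid (swapPP j k)
Valid-swapPP j k i i∉ with ∨-false (trans (sym (lookup-swapPP j k i)) (∉⇒false i∉))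
... | i≢j , i≢k = transpose-other j k i (differ i≢j) (differ i≢k)
  where
  differ : ∀ {x} → eqᵇ i x ≡ false → i ≢ x
  differ {x} f e with () ← trans (sym f) (dec-true (i FinP.≟ x) e)

InB-ξ : ∀ {n} (k : Fin n) → InB (ξ k)
InB-ξ {n} k = AllP.map⁺ (All.universal (λ j → Valid-swapPP j k) (filterᵇ (λ j → below j k) (allFin n)))

InB-sumB : ∀ {X : Set} {n} (E : List X) (F : X → B n) → (∀ α → InB (F α)) → InB (sumB E F)
InB-sumB []      F v = []
InB-sumB (α ∷ E) F v = InB-++ (v α) (InB-sumB E F v)

InB-evalSym′ : ∀ {m n} (f : SymFun) (x : Fin m → B n) → (∀ k → InB (x k)) → InB (evalSym′ f x)
InB-evalSym′ {m} f x v = InB-sumB f _ λ (c , λp) →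
  InB-· c (InB-sumB (exponents m λp) (monomial x) (good-monomial InB-closed x v))

fξ-in-A : ∀ (f : SymFun) (n : ℕ) → InA (fξ f n)
fξ-in-A f n = InB-evalSym′ f ξ InB-ξ , invariant f

lookup-∷ʳ-inject₁ : ∀ {A : Set} {n} (ys : Vec A n) (y : A) j → lookup (ys ∷ʳ y) (inject₁ j) ≡ lookup ys j
lookup-∷ʳ-inject₁ (a Vec.∷ ys) y Fin.zero    = refl
lookup-∷ʳ-inject₁ (a Vec.∷ ys) y (Fin.suc j) = lookup-∷ʳ-inject₁ ys y j

lookup-∷ʳ-last : ∀ {A : Set} {n} (ys : Vec A n) (y : A) → lookup (ys ∷ʳ y) (fromℕ n) ≡ y
lookup-∷ʳ-last Vec.[]       y = refl
lookup-∷ʳ-last (a Vec.∷ ys) y = lookup-∷ʳ-last ys y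

init∷ʳlast : ∀ {A : Set} {n} (d : Vec A (suc n)) → d ≡ Vec.init d ∷ʳ Vec.last d
init∷ʳlast d = proj₂ (proj₂ (Vec.initLast d))

lookup-init : ∀ {A : Set} {n} (d : Vec A (suc n)) j → lookup (Vec.init d) j ≡ lookup d (inject₁ j)
lookup-init d j = trans (sym (lookup-∷ʳ-inject₁ (Vec.init d) (Vec.last d) j))
                        (cong (λ v → lookup v (inject₁ j)) (sym (init∷ʳlast d)))

last≡lookup : ∀ {A : Set} {n} (d : Vec A (suc n)) → Vec.last d ≡ lookup d (fromℕ n)
last≡lookup {n = n} d = trans (sym (lookup-∷ʳ-last (Vec.init d) (Vec.last d)))
                              (cong (λ v → lookup v (fromℕ n)) (sym (init∷ʳlast d)))

last-∪ : ∀ {n} (d e : Subset (suc n)) → Vec.last (d ∪ e) ≡ (Vec.last d ∨ Vec.last e)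
last-∪ {n} d e = trans (last≡lookup (d ∪ e))
  (trans (lookup-∪ d e (fromℕ n)) (sym (cong₂ _∨_ (last≡lookup d) (last≡lookup e))))

last-or-inject₁ : ∀ {n} (k : Fin (suc n)) → (k ≡ fromℕ n) ⊎ Σ (Fin n) (λ j → k ≡ inject₁ j)
last-or-inject₁ {zero}  Fin.zero    = inj₁ refl
last-or-inject₁ {suc n} Fin.zero    = inj₂ (Fin.zero , refl)
last-or-inject₁ {suc n} (Fin.suc k) with last-or-inject₁ k
... | inj₁ e       = inj₁ (cong Fin.suc e)
... | inj₂ (j , e) = inj₂ (Fin.suc j , cong Fin.suc e)

punchIn-fromℕ : ∀ {n} (j : Fin n) → punchIn (fromℕ n) j ≡ inject₁ j
punchIn-fromℕ Fin.zero    = refl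
punchIn-fromℕ (Fin.suc j) = cong Fin.suc (punchIn-fromℕ j)

module Projection {n : ℕ} where
  ⋆ : Fin (suc n)
  ⋆ = fromℕ n

  restrict : PP (suc n) → PP n
  restrict (σ , d) = (remove ⋆ σ , Vec.init d)

  -- The functional g ∘ π_n, on basis elements.
  pullback : (PP n → ℚ) → PP (suc n) → ℚ
  pullback g (σ , d) = if Vec.last d then 0ℚ else g (restrict (σ , d))

  Lin-π : ∀ (g : PP n → ℚ) (a : B (suc n)) → Lin g (π a) ≡ Lin (pullback g) a
  Lin-π g []                  = refl
  Lin-π g ((c , (σ , d)) ∷ a) =
    trans (Lin-++ g (πPP (c , (σ , d))) (π a))
      (cong₂ Q._+_ term (Lin-π g a))
    where
    term : Lin g (πPP (c , (σ , d))) ≡ c Q.* pullback g (σ , d)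
    term with Vec.last d
    ... | true  = sym (QP.*-zeroʳ c)
    ... | false = QP.+-identityʳ _

  fixes-⋆ : ∀ (y : PP (suc n)) → Valid y → Vec.last (proj₂ y) ≡ false → proj₁ y ⟨$⟩ʳ ⋆ ≡ ⋆
  fixes-⋆ (σ , d) v e = v ⋆ (false⇒∉ (trans (sym (last≡lookup d)) e))

  remove-inject₁ : ∀ (σ : Permutation′ (suc n)) → σ ⟨$⟩ʳ ⋆ ≡ ⋆ →
    ∀ j → σ ⟨$⟩ʳ (inject₁ j) ≡ inject₁ (remove ⋆ σ ⟨$⟩ʳ j)
  remove-inject₁ σ f j = begin
    σ ⟨$⟩ʳ inject₁ j                        ≡⟨ cong (σ ⟨$⟩ʳ_) (punchIn-fromℕ j) ⟨
    σ ⟨$⟩ʳ punchIn ⋆ j                      ≡⟨ punchIn-permute σ ⋆ j ⟩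
    punchIn (σ ⟨$⟩ʳ ⋆) (remove ⋆ σ ⟨$⟩ʳ j)  ≡⟨ cong (λ z → punchIn z (remove ⋆ σ ⟨$⟩ʳ j)) f ⟩
    punchIn ⋆ (remove ⋆ σ ⟨$⟩ʳ j)           ≡⟨ punchIn-fromℕ _ ⟩
    inject₁ (remove ⋆ σ ⟨$⟩ʳ j)             ∎
    where open ≡-Reasoning

  restrict-mulPP : ∀ (y z : PP (suc n)) → proj₁ y ⟨$⟩ʳ ⋆ ≡ ⋆ → proj₁ z ⟨$⟩ʳ ⋆ ≡ ⋆ →
    restrict (mulPP y z) ≐ mulPP (restrict y) (restrict z)
  restrict-mulPP (σ , d) (τ , e) fσ fτ =
    (λ j → FinP.inject₁-injective (begin
      inject₁ (remove ⋆ (τ ∘ₚ σ) ⟨$⟩ʳ j)   ≡⟨ remove-inject₁ (τ ∘ₚ σ) (trans (cong (σ ⟨$⟩ʳ_) fτ) fσ) j ⟨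
      σ ⟨$⟩ʳ (τ ⟨$⟩ʳ inject₁ j)            ≡⟨ cong (σ ⟨$⟩ʳ_) (remove-inject₁ τ fτ j) ⟩
      σ ⟨$⟩ʳ inject₁ (remove ⋆ τ ⟨$⟩ʳ j)   ≡⟨ remove-inject₁ σ fσ _ ⟩
      inject₁ (remove ⋆ σ ⟨$⟩ʳ (remove ⋆ τ ⟨$⟩ʳ j)) ∎)) ,
    (λ j → trans (lookup-init (d ∪ e) j) (trans (lookup-∪ d e (inject₁ j))
             (trans (cong₂ _∨_ (sym (lookup-init d j)) (sym (lookup-init e j)))
                    (sym (lookup-∪ (Vec.init d) (Vec.init e) j)))))
    where open ≡-Reasoning

  Lin-cong-valid : ∀ {m} {g h : PP m → ℚ} (a : B m) → InB a → (∀ y → Valid y → g y ≡ h y) → Lin g a ≡ Lin h a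
  Lin-cong-valid []            []       f = refl
  Lin-cong-valid ((c , y) ∷ a) (v ∷ vs) f = cong₂ Q._+_ (cong (c Q.*_) (f y v)) (Lin-cong-valid a vs f)

  -- π is multiplicative on valid elements: a product involving n+1 in its
  -- domain has a factor involving n+1, and otherwise restriction commutes
  -- with the product.
  pullback-mul : ∀ (g : PP n → ℚ) → Respectful g → (b : B (suc n)) → InB b → (y : PP (suc n)) → Valid y →
    Lin (λ z → pullback g (mulPP y z)) b ≡ pullback (λ y' → Lin (λ z' → g (mulPP y' z')) (π b)) y
  pullback-mul g rg b vb (σ , d) vy with Vec.last d in ld
  ... | true  = trans (Lin-cong b (λ (τ , e) → zero-term τ e)) (Lin-0 b)
    where
    zero-term : ∀ τ e → pullback g (mulPP (σ , d) (τ , e)) ≡ 0ℚ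
    zero-term τ e rewrite last-∪ d e | ld = refl
  ... | false = trans (Lin-cong-valid b vb (λ z vz → term z vz)) (sym (Lin-π _ b))
    where
    term : ∀ z → Valid z → pullback g (mulPP (σ , d) z) ≡ pullback (λ z' → g (mulPP (restrict (σ , d)) z')) z
    term (τ , e) vz with Vec.last e in le
    ... | true  rewrite last-∪ d e | ld | le = refl
    ... | false rewrite last-∪ d e | ld | le =
      rg (restrict-mulPP (σ , d) (τ , e) (fixes-⋆ (σ , d) vy ld) (fixes-⋆ (τ , e) vz le))

  π-* : ∀ {a b : B (suc n)} → InB a → InB b → π (a *B b) ≃ π a *B π b
  π-* {a} {b} va vb = functionally λ g rg → begin
    Lin g (π (a *B b))                                      ≡⟨ Lin-π g (a *B b) ⟩
    Lin (pullback g) (a *B b)                               ≡⟨ Lin-* (pullback g) a b ⟩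
    Lin (λ y → Lin (λ z → pullback g (mulPP y z)) b) a      ≡⟨ Lin-cong-valid a va (pullback-mul g rg b vb) ⟩
    Lin (pullback (λ y' → Lin (λ z' → g (mulPP y' z')) (π b))) a ≡⟨ Lin-π _ a ⟨
    Lin (λ y' → Lin (λ z' → g (mulPP y' z')) (π b)) (π a)   ≡⟨ Lin-* g (π a) (π b) ⟨
    Lin g (π a *B π b)                                      ∎
    where open ≡-Reasoning

  π-+ : ∀ (a b : B (suc n)) → π (a +B b) ≃ π a +B π b
  π-+ a b = functionally λ g rg → trans (Lin-π g (a ++ b)) (trans (Lin-++ (pullback g) a b)
    (sym (trans (Lin-++ g (π a) (π b)) (cong₂ Q._+_ (Lin-π g a) (Lin-π g b)))))

  π-· : ∀ (c : ℚ) (a : B (suc n)) → π (c ·B a) ≃ c ·B π a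
  π-· c a = functionally λ g rg → trans (Lin-π g (c ·B a)) (trans (Lin-· (pullback g) c a)
    (sym (trans (Lin-· g c (π a)) (cong (c Q.*_) (Lin-π g a)))))

  π-1 : π (1B {suc n}) ≃ 1B
  π-1 = functionally λ g rg → trans (Lin-π g 1B) (trans (Lin-1B (pullback g)) (trans (unit g rg) (sym (Lin-1B g))))
    where
    unit : ∀ (g : PP n → ℚ) → Respectful g → pullback g e₀ ≡ g e₀
    unit g rg rewrite last≡lookup (∅ {suc n}) | lookup-∅ (fromℕ n) =
      rg ((λ j → FinP.inject₁-injective (sym (remove-inject₁ id refl j))) ,
          (λ j → trans (lookup-init ∅ j) (trans (lookup-∅ (inject₁ j)) (sym (lookup-∅ j)))))

  π-algebraMap : AlgebraMap (π {n}) InB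
  π-algebraMap = record
    { φ-0 = ≃-refl ; φ-+ = π-+ ; φ-· = π-· ; φ-1 = π-1 ; φ-* = π-* ; closed = InB-closed }

transpose-inject₁ : ∀ {n} (a b x : Fin n) →
  transpose (inject₁ a) (inject₁ b) ⟨$⟩ʳ (inject₁ x) ≡ inject₁ (transpose a b ⟨$⟩ʳ x)
transpose-inject₁ a b x = cases (x FinP.≟ a) (x FinP.≟ b)
  where
  cases : Dec (x ≡ a) → Dec (x ≡ b) → transpose (inject₁ a) (inject₁ b) ⟨$⟩ʳ (inject₁ x) ≡ inject₁ (transpose a b ⟨$⟩ʳ x)
  cases (yes refl) _ = trans (transpose-left (inject₁ x) (inject₁ b)) (cong inject₁ (sym (transpose-left x b)))
  cases (no _) (yes refl) = trans (transpose-right (inject₁ a) (inject₁ x)) (cong inject₁ (sym (transpose-right a x)))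
  cases (no xa) (no xb) =
    trans (transpose-other _ _ _ (λ e → xa (FinP.inject₁-injective e)) (λ e → xb (FinP.inject₁-injective e)))
          (cong inject₁ (sym (transpose-other a b x xa xb)))

eqᵇ-inject₁ : ∀ {n} (x a : Fin n) → eqᵇ (inject₁ x) (inject₁ a) ≡ eqᵇ x a
eqᵇ-inject₁ x a = does-cong (inject₁ x FinP.≟ inject₁ a) (x FinP.≟ a) FinP.inject₁-injective (cong inject₁)

last-swapPP : ∀ {n} (a b : Fin (suc n)) → Vec.last (proj₂ (swapPP a b)) ≡ (eqᵇ (fromℕ n) a ∨ eqᵇ (fromℕ n) b)
last-swapPP {n} a b = trans (last≡lookup (proj₂ (swapPP a b))) (lookup-swapPP a b (fromℕ n))

module _ {n : ℕ} where
  open Projection {n}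

  restrict-swapPP : ∀ (a b : Fin n) → restrict (swapPP (inject₁ a) (inject₁ b)) ≐ swapPP a b
  restrict-swapPP a b =
    (λ x → FinP.inject₁-injective (trans (sym (remove-inject₁ (transpose (inject₁ a) (inject₁ b)) fixed x))
                                         (transpose-inject₁ a b x))) ,
    (λ x → trans (lookup-init (⁅ inject₁ a ⁆ ∪ ⁅ inject₁ b ⁆) x)
             (trans (lookup-swapPP (inject₁ a) (inject₁ b) (inject₁ x))
                    (trans (cong₂ _∨_ (eqᵇ-inject₁ x a) (eqᵇ-inject₁ x b)) (sym (lookup-swapPP a b x)))))
    where
    fixed : transpose (inject₁ a) (inject₁ b) ⟨$⟩ʳ ⋆ ≡ ⋆
    fixed = transpose-other _ _ _ FinP.fromℕ≢inject₁ FinP.fromℕ≢inject₁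

  pullback-avoiding : ∀ (g : PP n → ℚ) (y : PP (suc n)) → Vec.last (proj₂ y) ≡ false → pullback g y ≡ g (restrict y)
  pullback-avoiding g (σ , d) e rewrite e = refl

  pullback-swapPP : ∀ (g : PP n → ℚ) → Respectful g → (a b : Fin n) →
    pullback g (swapPP (inject₁ a) (inject₁ b)) ≡ g (swapPP a b)
  pullback-swapPP g rg a b =
    trans (pullback-avoiding g (swapPP (inject₁ a) (inject₁ b))
             (trans (last-swapPP (inject₁ a) (inject₁ b)) (cong₂ _∨_ (⋆≢ a) (⋆≢ b))))
          (rg (restrict-swapPP a b))
    where
    ⋆≢ : ∀ c → eqᵇ ⋆ (inject₁ c) ≡ false
    ⋆≢ c = dec-false (⋆ FinP.≟ inject₁ c) FinP.fromℕ≢inject₁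

  below-inject₁ : ∀ (a b : Fin n) → below (inject₁ a) (inject₁ b) ≡ below a b
  below-inject₁ a b = cong₂ ℕ._<ᵇ_ (FinP.toℕ-inject₁ a) (FinP.toℕ-inject₁ b)

  π-ξ-inject₁ : ∀ (k : Fin n) → π (ξ {suc n} (inject₁ k)) ≃ ξ k
  π-ξ-inject₁ k = functionally λ g rg → begin
    Lin g (π (ξ (inject₁ k)))
      ≡⟨ trans (Lin-π g (ξ (inject₁ k))) (Lin-ξ (pullback g) (inject₁ k)) ⟩
    sum (λ i → ind (below i (inject₁ k)) Q.* pullback g (swapPP i (inject₁ k)))
      ≡⟨ sum-init-last (λ i → ind (below i (inject₁ k)) Q.* pullback g (swapPP i (inject₁ k))) ⟩
    sum (λ j → ind (below (inject₁ j) (inject₁ k)) Q.* pullback g (swapPP (inject₁ j) (inject₁ k)))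
      Q.+ ind (below ⋆ (inject₁ k)) Q.* pullback g (swapPP ⋆ (inject₁ k))
      ≡⟨ cong₂ Q._+_ (sum-cong-≗ (λ j → cong₂ Q._*_ (cong ind (below-inject₁ j k)) (pullback-swapPP g rg j k)))
                     (trans (cong (λ b → ind b Q.* pullback g (swapPP ⋆ (inject₁ k))) last-not-below)
                            (QP.*-zeroˡ (pullback g (swapPP ⋆ (inject₁ k))))) ⟩
    sum (λ j → ind (below j k) Q.* g (swapPP j k)) Q.+ 0ℚ           ≡⟨ QP.+-identityʳ _ ⟩
    sum (λ j → ind (below j k) Q.* g (swapPP j k))                   ≡⟨ Lin-ξ g k ⟨
    Lin g (ξ k)                                                      ∎
    where
    open ≡-Reasoning
    last-not-below : below ⋆ (inject₁ k) ≡ false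
    last-not-below = ≮⇒below {j = ⋆} {k = inject₁ k} (λ p → NP.<-asym p
      (subst₂ ℕ._<_ (sym (FinP.toℕ-inject₁ k)) (sym (FinP.toℕ-fromℕ n)) (FinP.toℕ<n k)))

  -- Every summand of ξ_{n+1} contains n+1 in its domain.
  π-ξ-last : π (ξ {suc n} ⋆) ≃ 0B
  π-ξ-last = functionally λ g rg → begin
    Lin g (π (ξ ⋆))                                          ≡⟨ trans (Lin-π g (ξ ⋆)) (Lin-ξ (pullback g) ⋆) ⟩
    sum (λ i → ind (below i ⋆) Q.* pullback g (swapPP i ⋆))  ≡⟨ sum-cong-≗ (λ i → trans (cong (ind (below i ⋆) Q.*_) (vanish g i))
                                                                                       (QP.*-zeroʳ (ind (below i ⋆)))) ⟩
    sum {suc n} (λ _ → 0ℚ)                                   ≡⟨ sum-replicate-zero (suc n) ⟩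
    0ℚ                                                       ∎
    where
    open ≡-Reasoning
    vanish : ∀ (g : PP n → ℚ) i → pullback g (swapPP i ⋆) ≡ 0ℚ
    vanish g i rewrite last-swapPP i ⋆ | dec-true (⋆ FinP.≟ ⋆) refl | BoolP.∨-zeroʳ (eqᵇ ⋆ i) = refl

extend : ∀ {m} {X : Set} → (Fin m → X) → X → Fin (suc m) → X
extend {zero}  x z Fin.zero    = z
extend {suc m} x z Fin.zero    = x Fin.zero
extend {suc m} x z (Fin.suc k) = extend (λ j → x (Fin.suc j)) z k

extend-inject₁ : ∀ {m} {X : Set} (x : Fin m → X) (z : X) j → extend x z (inject₁ j) ≡ x j
extend-inject₁ {suc m} x z Fin.zero    = refl
extend-inject₁ {suc m} x z (Fin.suc j) = extend-inject₁ (λ j → x (Fin.suc j)) z j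

extend-last : ∀ {m} {X : Set} (x : Fin m → X) (z : X) → extend x z (fromℕ m) ≡ z
extend-last {zero}  x z = refl
extend-last {suc m} x z = extend-last (λ j → x (Fin.suc j)) z

allFin-∷ʳ : ∀ m → allFin (suc m) ≡ map inject₁ (allFin m) ++ (fromℕ m ∷ [])
allFin-∷ʳ zero    = refl
allFin-∷ʳ (suc m) = cong (Fin.zero ∷_) (begin
  List.tabulate Fin.suc                                      ≡⟨ ListP.map-tabulate (λ j → j) Fin.suc ⟨
  map Fin.suc (allFin (suc m))                               ≡⟨ cong (map Fin.suc) (allFin-∷ʳ m) ⟩
  map Fin.suc (map inject₁ (allFin m) ++ (fromℕ m ∷ []))     ≡⟨ ListP.map-++ Fin.suc (map inject₁ (allFin m)) (fromℕ m ∷ []) ⟩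
  map Fin.suc (map inject₁ (allFin m)) ++ (Fin.suc (fromℕ m) ∷ [])
    ≡⟨ cong (_++ (Fin.suc (fromℕ m) ∷ [])) (trans (sym (ListP.map-∘ (allFin m))) (ListP.map-∘ (allFin m))) ⟩
  map inject₁ (map Fin.suc (allFin m)) ++ (Fin.suc (fromℕ m) ∷ [])
    ≡⟨ cong (λ L → map inject₁ L ++ (Fin.suc (fromℕ m) ∷ [])) (ListP.map-tabulate (λ j → j) Fin.suc) ⟩
  map inject₁ (List.tabulate Fin.suc) ++ (Fin.suc (fromℕ m) ∷ []) ∎)
  where open ≡-Reasoning

Π-map : ∀ {n m k} (h : Fin m → Fin k) (L : List (Fin m)) (F : Fin k → B n) → Π (map h L) F ≡ Π L (λ i → F (h i))
Π-map h []      F = refl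
Π-map h (i ∷ L) F = cong (F (h i) *B_) (Π-map h L F)

monomial-extend : ∀ {m n} (x : Fin m → B n) (z : B n) (β : Vec ℕ m) (k : ℕ) →
  monomial (extend x z) (β ∷ʳ k) ≃ monomial x β *B ((z ^B k) *B 1B)
monomial-extend {m} {n} x z β k =
  ≃-trans (≃-reflexive (cong (λ L → Π L F) (allFin-∷ʳ m)))
    (≃-trans (Π-++ (map inject₁ (allFin m)) (fromℕ m ∷ []) F)
      (*-cong (≃-trans (≃-reflexive (Π-map inject₁ (allFin m) F))
                       (Π-cong (allFin m) (All.universal (λ i → ≃-reflexive
                         (cong₂ _^B_ (extend-inject₁ x z i) (lookup-∷ʳ-inject₁ β k i))) (allFin m))))
              (≃-reflexive (cong (_*B 1B) (cong₂ _^B_ (extend-last x z) (lookup-∷ʳ-last β k))))))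
  where
  F : Fin (suc m) → B n
  F i = extend x z i ^B lookup (β ∷ʳ k) i

listSum-vecsUpTo-∷ʳ : ∀ N m (φ : Vec ℕ (suc m) → ℚ) →
  listSum (vecsUpTo N (suc m)) φ ≡ listSum (vecsUpTo N m) (λ β → listSum (upTo (suc N)) (λ k → φ (β ∷ʳ k)))
listSum-vecsUpTo-∷ʳ N zero φ =
  trans (listSum-vecsUpTo N zero φ)
    (trans (listSum-cong (upTo (suc N)) (λ a → QP.+-identityʳ (φ (a Vec.∷ Vec.[])))) (sym (QP.+-identityʳ _)))
listSum-vecsUpTo-∷ʳ N (suc m) φ = begin
  listSum (vecsUpTo N (suc (suc m))) φ
    ≡⟨ listSum-vecsUpTo N (suc m) φ ⟩
  listSum K (λ a → listSum (vecsUpTo N (suc m)) (λ w → φ (a Vec.∷ w)))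
    ≡⟨ listSum-cong K (λ a → listSum-vecsUpTo-∷ʳ N m (λ w → φ (a Vec.∷ w))) ⟩
  listSum K (λ a → listSum V (λ β → listSum K (λ k → φ (a Vec.∷ (β ∷ʳ k)))))
    ≡⟨ listSum-comm K V (λ a β → listSum K (λ k → φ (a Vec.∷ (β ∷ʳ k)))) ⟩
  listSum V (λ β → listSum K (λ a → listSum K (λ k → φ (a Vec.∷ (β ∷ʳ k)))))
    ≡⟨ listSum-cong V (λ β → listSum-comm K K (λ a k → φ (a Vec.∷ (β ∷ʳ k)))) ⟩
  listSum V (λ β → listSum K (λ k → listSum K (λ a → φ (a Vec.∷ (β ∷ʳ k)))))
    ≡⟨ listSum-comm K V (λ k β → listSum K (λ a → φ (a Vec.∷ (β ∷ʳ k)))) ⟨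
  listSum K (λ k → listSum V (λ β → listSum K (λ a → φ (a Vec.∷ (β ∷ʳ k)))))
    ≡⟨ listSum-cong K (λ k → listSum-comm V K (λ β a → φ (a Vec.∷ (β ∷ʳ k)))) ⟩
  listSum K (λ k → listSum K (λ a → listSum V (λ β → φ (a Vec.∷ (β ∷ʳ k)))))
    ≡⟨ listSum-cong K (λ k → listSum-vecsUpTo N m (λ w → φ (w ∷ʳ k))) ⟨
  listSum K (λ k → listSum (vecsUpTo N (suc m)) (λ w → φ (w ∷ʳ k)))
    ≡⟨ listSum-comm K (vecsUpTo N (suc m)) (λ k β → φ (β ∷ʳ k)) ⟩
  listSum (vecsUpTo N (suc m)) (λ β → listSum K (λ k → φ (β ∷ʳ k))) ∎
  where
  open ≡-Reasoning
  K = upTo (suc N)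
  V = vecsUpTo N m

occ-∷ʳ0 : ∀ k xs → occ (suc k) (xs ++ (0 ∷ [])) ≡ occ (suc k) xs
occ-∷ʳ0 k []       = refl
occ-∷ʳ0 k (a ∷ xs) = trans (occ-∷ (suc k) a (xs ++ (0 ∷ [])))
  (trans (cong (λ z → if a ℕ.≡ᵇ suc k then suc z else z) (occ-∷ʳ0 k xs)) (sym (occ-∷ (suc k) a xs)))

map-applyUpTo-cong : ∀ {A : Set} (h : ℕ → ℕ) (f g : ℕ → A) → (∀ j → f (h j) ≡ g (h j)) →
  ∀ N → map f (applyUpTo h N) ≡ map g (applyUpTo h N)
map-applyUpTo-cong h f g p zero    = refl
map-applyUpTo-cong h f g p (suc N) = cong₂ _∷_ (p 0) (map-applyUpTo-cong (λ j → h (suc j)) f g (λ j → p (suc j)) N)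

isRearr-∷ʳ0 : ∀ {n} (λs : List ℕ) (β : Vec ℕ n) → isRearr λs (β ∷ʳ 0) ≡ isRearr λs β
isRearr-∷ʳ0 λs β = cong and (map-applyUpTo-cong suc
  (λ k → occ k (Vec.toList (β ∷ʳ 0)) ℕ.≡ᵇ occ k λs) (λ k → occ k (Vec.toList β) ℕ.≡ᵇ occ k λs)
  (λ j → cong (ℕ._≡ᵇ occ (suc j) λs) (trans (cong (occ (suc j)) (VecP.toList-∷ʳ 0 β)) (occ-∷ʳ0 j (Vec.toList β))))
  (sumℕ λs))

listSum-applyUpTo-0 : ∀ (h : ℕ → ℕ) (φ : ℕ → ℚ) → (∀ j → φ (h j) ≡ 0ℚ) → ∀ N → listSum (applyUpTo h N) φ ≡ 0ℚ
listSum-applyUpTo-0 h φ p zero    = refl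
listSum-applyUpTo-0 h φ p (suc N) =
  trans (cong₂ Q._+_ (p 0) (listSum-applyUpTo-0 (λ j → h (suc j)) φ (λ j → p (suc j)) N)) (QP.+-identityˡ 0ℚ)

-- Monomials with a positive last exponent vanish at z = 0; those with last
-- exponent 0 are the monomials of m_λ(x).
evalMonomialSym-extend-0 : ∀ {m n} (x : Fin m → B n) (λp : Partition) →
  evalMonomialSym (extend x 0B) λp ≃ evalMonomialSym x λp
evalMonomialSym-extend-0 {m} {n} x λp = functionally λ g rg → begin
  Lin g (evalMonomialSym (extend x 0B) λp)
    ≡⟨ trans (Lin-sumB g (exponents (suc m) λp) (monomial (extend x 0B))) (listSum-filter P (vecsUpTo N (suc m)) _) ⟩
  listSum (vecsUpTo N (suc m)) (λ α → ind (P α) Q.* Lin g (monomial (extend x 0B) α))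
    ≡⟨ listSum-vecsUpTo-∷ʳ N m _ ⟩
  listSum (vecsUpTo N m) (λ β → listSum (upTo (suc N)) (λ k → ind (P (β ∷ʳ k)) Q.* Lin g (monomial (extend x 0B) (β ∷ʳ k))))
    ≡⟨ listSum-cong (vecsUpTo N m) (λ β → last-exponent g rg β) ⟩
  listSum (vecsUpTo N m) (λ β → ind (P β) Q.* Lin g (monomial x β))
    ≡⟨ trans (Lin-sumB g (exponents m λp) (monomial x)) (listSum-filter P (vecsUpTo N m) _) ⟨
  Lin g (evalMonomialSym x λp) ∎
  where
  open ≡-Reasoning
  N = sumℕ (parts λp)
  P : ∀ {k} → Vec ℕ k → Bool
  P = isRearr (parts λp)
  last-exponent : ∀ (g : PP n → ℚ) → Respectful g → (β : Vec ℕ m) →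
    listSum (upTo (suc N)) (λ k → ind (P (β ∷ʳ k)) Q.* Lin g (monomial (extend x 0B) (β ∷ʳ k)))
      ≡ ind (P β) Q.* Lin g (monomial x β)
  last-exponent g rg β =
    trans (cong₂ Q._+_ (cong₂ Q._*_ (cong ind (isRearr-∷ʳ0 (parts λp) β)) zero-exponent)
                       (listSum-applyUpTo-0 suc _ (λ j → trans (cong (ind (P (β ∷ʳ suc j)) Q.*_) (positive-exponent j))
                                                              (QP.*-zeroʳ (ind (P (β ∷ʳ suc j))))) N))
          (QP.+-identityʳ _)
    where
    zero-exponent : Lin g (monomial (extend x 0B) (β ∷ʳ 0)) ≡ Lin g (monomial x β)
    zero-exponent = agree (≃-trans (monomial-extend x 0B β 0)
      (≃-trans (*-congˡ (monomial x β) (*-identityˡ 1B)) (*-identityʳ (monomial x β)))) g rg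
    positive-exponent : ∀ j → Lin g (monomial (extend x 0B) (β ∷ʳ suc j)) ≡ 0ℚ
    positive-exponent j = trans (agree (monomial-extend x 0B β (suc j)) g rg)
                                (trans (Lin-* g (monomial x β) _) (Lin-0 (monomial x β)))

evalSym′-extend-0 : ∀ {m n} (f : SymFun) (x : Fin m → B n) → evalSym′ f (extend x 0B) ≃ evalSym′ f x
evalSym′-extend-0 f x = sumB-cong f λ (c , λp) → ·-cong c (evalMonomialSym-extend-0 x λp)

-- Second half of Proposition 8: π_n f(ξ_1,…,ξ_{n+1}) = f(π_n ξ_1,…,π_n ξ_{n+1})
-- = f(ξ_1,…,ξ_n,0) = f(ξ_1,…,ξ_n).
π-fξ : ∀ (f : SymFun) (n : ℕ) → π (fξ f (suc n)) ≈ fξ f n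
π-fξ f n = ≃⇒≈ (≃-trans (φ-evalSym′ (Projection.π-algebraMap {n}) f ξ InB-ξ)
                  (≃-trans (evalSym′-cong f π-ξ) (evalSym′-extend-0 f ξ)))
  where
  π-ξ : ∀ (k : Fin (suc n)) → π (ξ k) ≃ extend ξ 0B k
  π-ξ k with last-or-inject₁ k
  ... | inj₁ refl       = ≃-trans π-ξ-last (≃-reflexive (sym (extend-last ξ 0B)))
  ... | inj₂ (j , refl) = ≃-trans (π-ξ-inject₁ j) (≃-reflexive (sym (extend-inject₁ ξ 0B j)))

proposition8 : (f : SymFun) →
    (∀ (n : ℕ) → n ≥ 1 → InA (fξ f n))
    × (∀ (n : ℕ) → n ≥ 1 → π (fξ f (suc n)) ≈ fξ f n)
proposition8 f = (λ n _ → fξ-in-A f n) , (λ n _ → π-fξ f n)
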